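{- For each positive integer $n$, let $V_n$ be the set of permutations $w\in S_n$ whose Schensted insertion produces no lateral bumps. Then \[\lim_{n\to\infty}\frac{|V_n|}{n!}=0.\]
   Context: Schensted insertion (French notation, rows numbered from the bottom): given $w=w_1w_2\cdots w_n\in S_n$ in one-line notation, start from the empty tableau and insert $w_1,\dots,w_n$ in turn. To insert a number $x$ into a row: if $x$ is larger than every entry of the row (or the row is empty), append $x$ at the end of the row; otherwise $x$ replaces the smallest entry $y$ of the row that is greater than $x$, and $y$ is "bumped" and inserted into the next row up by the same rule (a new row is created if needed). The result is a standard Young tableau. A bump of a number $y$ out of column $j$ of some row is called vertical if $y$ is then placed (by replacement or by appending) in column $j$ of the next row up; otherwise it is called lateral (in which case $y$ lands in a column strictly to the left of $j$). -}

module Defs where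

open import Data.Nat using (ℕ; zero; suc; _<ᵇ_; _≡ᵇ_; _≟_)
open import Data.Bool using (Bool; true; false; _∧_; if_then_else_)
open import Data.Maybe using (Maybe; just; nothing)
open import Data.Product using (_×_; _,_; proj₂)
open import Data.List using (List; []; _∷_; [_]; map; concatMap; foldl; filter; length; upTo)
open import Data.List.Relation.Unary.Unique.DecPropositional _≟_ using (Unique; unique?)
open import Relation.Binary.PropositionalEquality using (_≡_)
open import Data.Bool.Properties using () renaming (_≟_ to _≟B_)

-- Tableaux in French notation: a list of rows, bottom row first;
-- each row is a list of entries from left to right (columns 0,1,2,...).

-- Insert x into a single (increasing) row.  Returns the new row, the
-- column (0-indexed) where x is placed, and the bumped entry (if any),
-- which was sitting in that same column.
rowIns : ℕ → List ℕ → List ℕ × ℕ × Maybe ℕ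
rowIns x [] = [ x ] , 0 , nothing
rowIns x (y ∷ ys) with x <ᵇ y
... | true  = x ∷ ys , 0 , just y
... | false with rowIns x ys
...   | r , c , m = y ∷ r , suc c , m

-- Is a placement in column c consistent with a vertical bump from column src?
-- (nothing = the number is the one being inserted, not a bumped one.)
okBump : Maybe ℕ → ℕ → Bool
okBump nothing  _ = true
okBump (just j) c = j ≡ᵇ c

-- Insert x (bumped from column src, if src = just j) into the rows from the
-- current one upward.  The Bool is true iff no lateral bump occurred.
insRows : Maybe ℕ → ℕ → List (List ℕ) → List (List ℕ) × Bool
insRows src x [] = [ [ x ] ] , okBump src 0
insRows src x (r ∷ rs) with rowIns x r
... | r' , c , nothing = r' ∷ rs , okBump src c
... | r' , c , just y with insRows (just c) y rs
...   | rs' , b = r' ∷ rs' , (okBump src c ∧ b)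

step : List (List ℕ) × Bool → ℕ → List (List ℕ) × Bool
step (t , b) x with insRows nothing x t
... | t' , b' = t' , (b ∧ b')

schensted : List ℕ → List (List ℕ) × Bool
schensted w = foldl step ([] , true) w

NoLateral : List ℕ → Set
NoLateral w = proj₂ (schensted w) ≡ true

words : List ℕ → ℕ → List (List ℕ)
words as zero    = [ [] ]
words as (suc k) = concatMap (λ a → map (a ∷_) (words as k)) as

-- One-line notations of permutations in S_n: words of length n over
-- {1,...,n} with pairwise distinct entries.
perms : ℕ → List (List ℕ)
perms n = filter unique? (words (map suc (upTo n)) n)

countV : ℕ → ℕ
countV n = length (filter (λ w → proj₂ (schensted w) ≟B true) (perms n))

{-# OPTIONS --safe #-}
module Submission where

-- Without lateral bumps every bumped entry stays in its column, so a new row of the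
-- insertion tableau can only be started by a chain of bumps out of column 0, that is, by a
-- letter smaller than all letters inserted before it.  Hence the tableau of w ∈ V_n has at
-- most L(w) rows, L(w) being the number of left-to-right minima of w, while its bottom row
-- is no longer than the longest increasing subsequence of w.  Since the n entries fit into
-- this shape, ab < n forces L(w) > a or an increasing subsequence of length b + 1.
--
-- Both events are rare.  Recursing on the first letter, Σ_{w ∈ S_n} 2^{L(w)} = (n + 1)! and
-- the expected number of increasing subsequences of length b + 1 is C(n, b+1)/(b+1)!, at most
-- n^{b+1}/(b+1)!².  By Markov's inequality |V_n|/n! ≤ (n+1)/2^{a+1} + n^{b+1}/(b+1)!², and with
-- a ≈ log₂ n, b ≈ n/log₂ n both terms tend to 0 (the second because m^m ≤ 4^m m!).

open import Defs
open import Data.Nat using (ℕ; suc; _*_; _≤_; _<_)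
open import Data.Nat using (_!)
open import Data.Product using (∃-syntax)

open import Data.Bool using (Bool; true; false; _∧_; _∨_; not; if_then_else_; T)
open import Data.Bool.ListAction using (all)
open import Data.Bool.Properties using (T-≡; ∧-assoc; ∧-comm; ∧-zeroʳ) renaming (_≟_ to _≟ᴮ_)
open import Data.Empty using (⊥; ⊥-elim)
open import Data.List using (List; []; _∷_; [_]; _++_; map; concatMap; filter; foldl; length; upTo)
open import Data.List.Properties using (++-assoc; ++-identityʳ; length-++; length-map; length-applyUpTo)
open import Data.List.Membership.Propositional using (_∈_)
open import Data.List.Relation.Unary.Any using (here; there)
open import Data.List.Relation.Unary.All using (All; []; _∷_; lookup; tabulate)
import Data.List.Relation.Unary.All as All
import Data.List.Relation.Unary.All.Properties as All
open import Data.List.Relation.Unary.Unique.Propositional using (Unique; []; _∷_)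
import Data.List.Relation.Unary.Unique.Propositional.Properties as Unique
open import Data.Maybe using (Maybe; just; nothing)
open import Data.Nat
open import Data.Nat.Combinatorics.Base using (_P′_)
open import Data.Nat.Combinatorics.Specification using (nP′k≡n[n∸1P′k∸1])
open import Data.Nat.DivMod using (_/_; m≡m%n+[m/n]*n; m%n<n; m/n*n≤m)
open import Data.Nat.Properties
open import Data.Nat.Tactic.RingSolver using (solve-∀)
open import Data.List.Membership.DecPropositional _≟_ using (_∈?_)
open import Data.List.Relation.Unary.Unique.DecPropositional _≟_ using (unique?)
open import Data.Product using (Σ-syntax; _×_; _,_; proj₁; proj₂)
open import Data.Sum using (_⊎_; inj₁; inj₂)
open import Data.Unit using (⊤; tt)
open import Function using (_∘_)
open import Function.Bundles using (Equivalence)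
open import Relation.Binary.PropositionalEquality hiding ([_])
open import Relation.Nullary using (yes; no; does; ¬?)
open import Relation.Nullary.Reflects using (ofʸ; ofⁿ)

∧-true⁻ : ∀ {a b} → a ∧ b ≡ true → a ≡ true × b ≡ true
∧-true⁻ {true} {true} _ = refl , refl

<⇒<ᵇ≡true : ∀ {m n} → m < n → (m <ᵇ n) ≡ true
<⇒<ᵇ≡true m<n = Equivalence.to T-≡ (<⇒<ᵇ m<n)

≡ᵇ-refl : ∀ n → (n ≡ᵇ n) ≡ true
≡ᵇ-refl n = Equivalence.to T-≡ (≡⇒≡ᵇ n n refl)

≡ᵇ-true⁻ : ∀ {m n} → (m ≡ᵇ n) ≡ true → m ≡ n
≡ᵇ-true⁻ {m} {n} e = ≡ᵇ⇒≡ m n (subst T (sym e) tt)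

≡ᵇ-false : ∀ {m n} → m ≢ n → (m ≡ᵇ n) ≡ false
≡ᵇ-false {m} {n} m≢n with m ≡ᵇ n in e
... | true  = ⊥-elim (m≢n (≡ᵇ-true⁻ e))
... | false = refl

<ᵇ-suc : ∀ a v → (a <ᵇ suc v) ≡ (a <ᵇ v) ∨ (v ≡ᵇ a)
<ᵇ-suc zero    zero    = refl
<ᵇ-suc zero    (suc v) = refl
<ᵇ-suc (suc a) zero    = refl
<ᵇ-suc (suc a) (suc v) = <ᵇ-suc a v

<ᵇ-∧-≡ᵇ : ∀ a v → (a <ᵇ v) ∧ (v ≡ᵇ a) ≡ false
<ᵇ-∧-≡ᵇ zero    zero    = refl
<ᵇ-∧-≡ᵇ zero    (suc v) = refl
<ᵇ-∧-≡ᵇ (suc a) zero    = refl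
<ᵇ-∧-≡ᵇ (suc a) (suc v) = <ᵇ-∧-≡ᵇ a v

≡ᵇ-sym : ∀ a b → (a ≡ᵇ b) ≡ (b ≡ᵇ a)
≡ᵇ-sym zero    zero    = refl
≡ᵇ-sym zero    (suc b) = refl
≡ᵇ-sym (suc a) zero    = refl
≡ᵇ-sym (suc a) (suc b) = ≡ᵇ-sym a b

≤ᵇ-split : ∀ v a → (v ≤ᵇ a) ≡ (v <ᵇ a) ∨ (v ≡ᵇ a)
≤ᵇ-split zero    zero    = refl
≤ᵇ-split zero    (suc a) = refl
≤ᵇ-split (suc v) zero    = refl
≤ᵇ-split (suc v) (suc a) = trans (<ᵇ-suc v a) (cong ((v <ᵇ a) ∨_) (≡ᵇ-sym a v))

<ᵇ-∧-≡ᵇ′ : ∀ v a → (v <ᵇ a) ∧ (v ≡ᵇ a) ≡ false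
<ᵇ-∧-≡ᵇ′ v a = trans (cong ((v <ᵇ a) ∧_) (≡ᵇ-sym v a)) (<ᵇ-∧-≡ᵇ v a)

<⇒≤ᵇ≡false : ∀ {a v} → a < v → (v ≤ᵇ a) ≡ false
<⇒≤ᵇ≡false {a} {v} a<v with v ≤ᵇ a | ≤ᵇ-reflects-≤ v a
... | true  | ofʸ v≤a = ⊥-elim (<⇒≱ a<v v≤a)
... | false | _       = refl

𝟙 : Bool → ℕ
𝟙 b = if b then 1 else 0

𝟙≤1 : ∀ b → 𝟙 b ≤ 1
𝟙≤1 true  = ≤-refl
𝟙≤1 false = z≤n

sumOver : {X : Set} → (X → ℕ) → List X → ℕ
sumOver f []       = 0
sumOver f (x ∷ xs) = f x + sumOver f xs

syntax sumOver (λ x → e) xs = ∑[ x ∈ xs ] e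

module _ {X : Set} where

  sumOver-++ : ∀ (f : X → ℕ) xs ys → sumOver f (xs ++ ys) ≡ sumOver f xs + sumOver f ys
  sumOver-++ f []       ys = refl
  sumOver-++ f (x ∷ xs) ys = trans (cong (f x +_) (sumOver-++ f xs ys)) (sym (+-assoc (f x) _ _))

  sumOver-cong : ∀ {f g : X → ℕ} → (∀ x → f x ≡ g x) → ∀ xs → sumOver f xs ≡ sumOver g xs
  sumOver-cong f≗g []       = refl
  sumOver-cong f≗g (x ∷ xs) = cong₂ _+_ (f≗g x) (sumOver-cong f≗g xs)

  sumOver-congᴬ : ∀ {P : X → Set} {f g : X → ℕ} {xs} → All P xs → (∀ {x} → P x → f x ≡ g x) →
                  sumOver f xs ≡ sumOver g xs
  sumOver-congᴬ []       f≗g = refl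
  sumOver-congᴬ (p ∷ ps) f≗g = cong₂ _+_ (f≗g p) (sumOver-congᴬ ps f≗g)

  sumOver-mono : ∀ {f g : X → ℕ} → (∀ x → f x ≤ g x) → ∀ xs → sumOver f xs ≤ sumOver g xs
  sumOver-mono f≤g []       = z≤n
  sumOver-mono f≤g (x ∷ xs) = +-mono-≤ (f≤g x) (sumOver-mono f≤g xs)

  sumOver-monoᴬ : ∀ {P : X → Set} {f g : X → ℕ} {xs} → All P xs → (∀ {x} → P x → f x ≤ g x) →
                  sumOver f xs ≤ sumOver g xs
  sumOver-monoᴬ []       f≤g = z≤n
  sumOver-monoᴬ (p ∷ ps) f≤g = +-mono-≤ (f≤g p) (sumOver-monoᴬ ps f≤g)

  sumOver-+ : ∀ (f g : X → ℕ) xs → ∑[ x ∈ xs ] (f x + g x) ≡ sumOver f xs + sumOver g xs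
  sumOver-+ f g []       = refl
  sumOver-+ f g (x ∷ xs) rewrite sumOver-+ f g xs = +-assoc-swap (f x) (g x) (sumOver f xs) (sumOver g xs)
    where
    +-assoc-swap : ∀ a b c d → a + b + (c + d) ≡ a + c + (b + d)
    +-assoc-swap = solve-∀

  sumOver-*ˡ : ∀ c (f : X → ℕ) xs → ∑[ x ∈ xs ] (c * f x) ≡ c * sumOver f xs
  sumOver-*ˡ c f []       = sym (*-zeroʳ c)
  sumOver-*ˡ c f (x ∷ xs) = trans (cong (c * f x +_) (sumOver-*ˡ c f xs)) (sym (*-distribˡ-+ c (f x) _))

  sumOver-0 : ∀ (xs : List X) → ∑[ x ∈ xs ] 0 ≡ 0
  sumOver-0 []       = refl
  sumOver-0 (_ ∷ xs) = sumOver-0 xs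

sumOver-concatMap : ∀ {X Y : Set} (f : Y → ℕ) (h : X → List Y) xs →
                    sumOver f (concatMap h xs) ≡ ∑[ x ∈ xs ] sumOver f (h x)
sumOver-concatMap f h []       = refl
sumOver-concatMap f h (x ∷ xs) =
  trans (sumOver-++ f (h x) (concatMap h xs)) (cong (sumOver f (h x) +_) (sumOver-concatMap f h xs))

sumOver-map : ∀ {X Y : Set} (f : Y → ℕ) (h : X → Y) xs → sumOver f (map h xs) ≡ ∑[ x ∈ xs ] f (h x)
sumOver-map f h []       = refl
sumOver-map f h (x ∷ xs) = cong (f (h x) +_) (sumOver-map f h xs)

sumOver-absent : ∀ (g : ℕ → ℕ) {a} xs → All (a ≢_) xs → ∑[ x ∈ xs ] (if a ≡ᵇ x then g x else 0) ≡ 0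
sumOver-absent g []       []           = refl
sumOver-absent g (x ∷ xs) (a≢x ∷ a∉xs) rewrite ≡ᵇ-false a≢x = sumOver-absent g xs a∉xs

sumOver-point : ∀ (g : ℕ → ℕ) {a} xs → Unique xs → a ∈ xs → ∑[ x ∈ xs ] (if a ≡ᵇ x then g x else 0) ≡ g a
sumOver-point g (x ∷ xs) (x∉xs ∷ _) (here refl)
  rewrite ≡ᵇ-refl x = trans (cong (g x +_) (sumOver-absent g xs x∉xs)) (+-identityʳ (g x))
sumOver-point g {a} (x ∷ xs) (x∉xs ∷ xs-unique) (there a∈xs)
  rewrite ≡ᵇ-false {a} {x} (λ { refl → lookup x∉xs a∈xs refl }) = sumOver-point g xs xs-unique a∈xs

sumBelow : ℕ → (ℕ → ℕ) → ℕ
sumBelow zero    h = 0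
sumBelow (suc M) h = sumBelow M h + h M

syntax sumBelow M (λ j → e) = ∑[ j < M ] e

sumBelow-extend : ∀ h M c → c ≤ 1 → ∑[ j < M ] h j + c * h M ≡ ∑[ j < M + c ] h j
sumBelow-extend h M zero    _ rewrite +-identityʳ M = +-identityʳ (sumBelow M h)
sumBelow-extend h M (suc zero) _ rewrite +-comm M 1 | +-identityʳ (h M) = refl
sumBelow-extend h M (suc (suc _)) (s≤s ())

∑[j<M]2[1+j]≡M[1+M] : ∀ M → ∑[ j < M ] (2 * suc j) ≡ M * suc M
∑[j<M]2[1+j]≡M[1+M] zero    = refl
∑[j<M]2[1+j]≡M[1+M] (suc M) rewrite ∑[j<M]2[1+j]≡M[1+M] M = square-step M
  where
  square-step : ∀ M → M * suc M + 2 * suc M ≡ suc M * suc (suc M)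
  square-step = solve-∀

-- Falling factorials

-- Although the library calls _P′_ valid only for k ≤ n, n P′ k is the falling factorial
-- n (n-1) ⋯ (n-k+1) for all n and k, and vanishes for k > n.

n<k⇒nP′k≡0 : ∀ {n k} → n < k → n P′ k ≡ 0
n<k⇒nP′k≡0 {n} {suc k} n<1+k with m≤n⇒m<n∨m≡n (≤-pred n<1+k)
... | inj₁ n<k  rewrite n<k⇒nP′k≡0 n<k = *-zeroʳ (n ∸ k)
... | inj₂ refl rewrite n∸n≡0 n = refl

P′-mono : ∀ {m n} k → m ≤ n → m P′ k ≤ n P′ k
P′-mono zero    m≤n = ≤-refl
P′-mono (suc k) m≤n = *-mono-≤ (∸-monoˡ-≤ k m≤n) (P′-mono k m≤n)

P′≤^ : ∀ n k → n P′ k ≤ n ^ k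
P′≤^ n zero    = ≤-refl
P′≤^ n (suc k) = *-mono-≤ (m∸n≤m n k) (P′≤^ n k)

n*[pred-n]P′k≡nP′[1+k] : ∀ n k → n * (pred n P′ k) ≡ n P′ suc k
n*[pred-n]P′k≡nP′[1+k] zero    zero    = refl
n*[pred-n]P′k≡nP′[1+k] zero    (suc k) = refl
n*[pred-n]P′k≡nP′[1+k] (suc n) k = sym (nP′k≡n[n∸1P′k∸1] (suc n) (suc k))

nP′[1+k]+k*nP′k≡n*nP′k : ∀ n k → n P′ suc k + k * (n P′ k) ≡ n * (n P′ k)
nP′[1+k]+k*nP′k≡n*nP′k n k with k ≤? n
... | yes k≤n = trans (sym (*-distribʳ-+ (n P′ k) (n ∸ k) k)) (cong (_* (n P′ k)) (m∸n+n≡m k≤n))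
... | no  k≰n rewrite n<k⇒nP′k≡0 (≰⇒> k≰n) | *-zeroʳ k | *-zeroʳ n | *-zeroʳ (n ∸ k) = refl

P′-pascal : ∀ n k → suc n P′ suc k ≡ n P′ suc k + suc k * (n P′ k)
P′-pascal n k = begin
  suc n P′ suc k                       ≡⟨ sym (n*[pred-n]P′k≡nP′[1+k] (suc n) k) ⟩
  n P′ k + n * (n P′ k)                ≡⟨ cong (n P′ k +_) (sym (nP′[1+k]+k*nP′k≡n*nP′k n k)) ⟩
  n P′ k + (n P′ suc k + k * (n P′ k)) ≡⟨ rearrange (n P′ k) (n P′ suc k) k ⟩
  n P′ suc k + suc k * (n P′ k)        ∎
  where
  open ≡-Reasoning
  rearrange : ∀ p q k → p + (q + k * p) ≡ q + suc k * p
  rearrange = solve-∀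

[1+b]*∑[j<M]jP′b≡MP′[1+b] : ∀ b M → suc b * ∑[ j < M ] (j P′ b) ≡ M P′ suc b
[1+b]*∑[j<M]jP′b≡MP′[1+b] b zero    = trans (*-zeroʳ (suc b)) (sym (n<k⇒nP′k≡0 {0} {suc b} z<s))
[1+b]*∑[j<M]jP′b≡MP′[1+b] b (suc M) = begin
  suc b * (∑[ j < M ] (j P′ b) + M P′ b)         ≡⟨ *-distribˡ-+ (suc b) _ (M P′ b) ⟩
  suc b * ∑[ j < M ] (j P′ b) + suc b * (M P′ b) ≡⟨ cong (_+ suc b * (M P′ b)) ([1+b]*∑[j<M]jP′b≡MP′[1+b] b M) ⟩
  M P′ suc b + suc b * (M P′ b)                  ≡⟨ sym (P′-pascal M b) ⟩
  suc M P′ suc b                                 ∎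
  where open ≡-Reasoning

-- Factorial and exponential estimates

x*[y*z]≡y*[x*z] : ∀ x y z → x * (y * z) ≡ y * (x * z)
x*[y*z]≡y*[x*z] = solve-∀

^-distribʳ-* : ∀ x y n → (x * y) ^ n ≡ x ^ n * y ^ n
^-distribʳ-* x y zero    = refl
^-distribʳ-* x y (suc n) rewrite ^-distribʳ-* x y n = swap x y (x ^ n) (y ^ n)
  where
  swap : ∀ x y p q → x * y * (p * q) ≡ x * p * (y * q)
  swap = solve-∀

m^j*m!≤[j+m]! : ∀ m j → m ^ j * m ! ≤ (j + m) !
m^j*m!≤[j+m]! m zero    = ≤-reflexive (+-identityʳ (m !))
m^j*m!≤[j+m]! m (suc j) = begin
  m * m ^ j * m !       ≡⟨ *-assoc m (m ^ j) (m !) ⟩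
  m * (m ^ j * m !)     ≤⟨ *-mono-≤ (m≤n+m m (suc j)) (m^j*m!≤[j+m]! m j) ⟩
  suc (j + m) * (j + m) ! ∎
  where open ≤-Reasoning

[m+m]!≤4^m*[m!*m!] : ∀ m → (m + m) ! ≤ 4 ^ m * (m ! * m !)
[m+m]!≤4^m*[m!*m!] zero    = ≤-refl
[m+m]!≤4^m*[m!*m!] (suc m) rewrite +-suc m m = begin
  (2 + m + m) * ((1 + m + m) * (m + m) !) ≤⟨ *-monoʳ-≤ (2 + m + m) (*-monoʳ-≤ (1 + m + m) ([m+m]!≤4^m*[m!*m!] m)) ⟩
  (2 + m + m) * ((1 + m + m) * Y)        ≡⟨ sym (*-assoc (2 + m + m) (1 + m + m) Y) ⟩
  (2 + m + m) * (1 + m + m) * Y          ≤⟨ *-monoˡ-≤ Y (≤-trans (m≤m+n _ (2 + m + m)) (≤-reflexive (central-binomial-step m))) ⟩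
  4 * (suc m * suc m) * Y                ≡⟨ regroup (suc m) (m !) (4 ^ m) ⟩
  4 * 4 ^ m * (suc m * m ! * (suc m * m !)) ∎
  where
  open ≤-Reasoning
  Y : ℕ
  Y = 4 ^ m * (m ! * m !)
  central-binomial-step : ∀ m → (2 + m + m) * (1 + m + m) + (2 + m + m) ≡ 4 * (suc m * suc m)
  central-binomial-step = solve-∀
  regroup : ∀ s f p → 4 * (s * s) * (p * (f * f)) ≡ 4 * p * (s * f * (s * f))
  regroup = solve-∀

m^m≤4^m*m! : ∀ m → m ^ m ≤ 4 ^ m * m !
m^m≤4^m*m! m = *-cancelʳ-≤ (m ^ m) (4 ^ m * m !) (m !) {{m !≢0}}
  (≤-trans (m^j*m!≤[j+m]! m m) (≤-trans ([m+m]!≤4^m*[m!*m!] m) (≤-reflexive (sym (*-assoc (4 ^ m) (m !) (m !))))))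

K*n^b<b!*b! : ∀ b K n → 0 < n → 32 * n ≤ b * b → K < 2 ^ b → K * n ^ b < b ! * b !
K*n^b<b!*b! b K n n>0 32n≤b² K<2^b = *-cancelˡ-< (16 ^ b) (K * n ^ b) (b ! * b !) (begin-strict
  16 ^ b * (K * n ^ b)        ≡⟨ x*[y*z]≡y*[x*z] (16 ^ b) K (n ^ b) ⟩
  K * (16 ^ b * n ^ b)        ≡⟨ cong (K *_) (sym (^-distribʳ-* 16 n b)) ⟩
  K * (16 * n) ^ b            <⟨ *-monoˡ-< ((16 * n) ^ b) {{16n^b≢0}} K<2^b ⟩
  2 ^ b * (16 * n) ^ b        ≡⟨ sym (^-distribʳ-* 2 (16 * n) b) ⟩
  (2 * (16 * n)) ^ b          ≡⟨ cong (_^ b) (sym (*-assoc 2 16 n)) ⟩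
  (32 * n) ^ b                ≤⟨ ^-monoˡ-≤ b 32n≤b² ⟩
  (b * b) ^ b                 ≡⟨ ^-distribʳ-* b b b ⟩
  b ^ b * b ^ b               ≤⟨ *-mono-≤ (m^m≤4^m*m! b) (m^m≤4^m*m! b) ⟩
  4 ^ b * b ! * (4 ^ b * b !) ≡⟨ regroup (4 ^ b) (b !) ⟩
  4 ^ b * 4 ^ b * (b ! * b !) ≡⟨ cong (_* (b ! * b !)) (sym (^-distribʳ-* 4 4 b)) ⟩
  16 ^ b * (b ! * b !)        ∎)
  where
  open ≤-Reasoning
  16n^b≢0 : NonZero ((16 * n) ^ b)
  16n^b≢0 = >-nonZero (m^n>0 (16 * n) {{>-nonZero (*-monoʳ-< 16 n>0)}} b)
  regroup : ∀ p f → p * f * (p * f) ≡ p * p * (f * f)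
  regroup = solve-∀

n<2^n : ∀ n → n < 2 ^ n
n<2^n zero    = s≤s z≤n
n<2^n (suc n) = subst (_≤ 2 ^ suc n) (+-comm (suc n) 1) (+-mono-≤ (n<2^n n) (≤-trans (m^n>0 2 n) (m≤m+n (2 ^ n) 0)))

log₂-bracket : ∀ m → 1 ≤ m → ∃[ a ] 2 ^ a ≤ m × m < 2 ^ suc a
log₂-bracket (suc zero)    _ = 0 , ≤-refl , s≤s (s≤s z≤n)
log₂-bracket (suc (suc m)) _ with log₂-bracket (suc m) (s≤s z≤n)
... | a , lo , hi with suc (suc m) <? 2 ^ suc a
...   | yes m+2<2^[1+a] = a , m≤n⇒m≤1+n lo , m+2<2^[1+a]
...   | no  m+2≮2^[1+a] =
  suc a , ≤-reflexive 2^[1+a]≡m+2 ,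
  subst (_< 2 ^ suc (suc a)) 2^[1+a]≡m+2 (m<m+n _ (≤-trans (m^n>0 2 (suc a)) (m≤m+n _ 0)))
  where
  2^[1+a]≡m+2 : 2 ^ suc a ≡ suc (suc m)
  2^[1+a]≡m+2 = ≤-antisym (≮⇒≥ m+2≮2^[1+a]) hi

cube≤2^ : ∀ a → 10 ≤ a → a * a * a ≤ 2 ^ a
cube≤2^ a 10≤a with m≤n⇒∃[o]m+o≡n 10≤a
... | t , refl = go t
  where
  cube-doubling : ∀ t → 2 * ((10 + t) * (10 + t) * (10 + t))
                      ≡ (11 + t) * (11 + t) * (11 + t) + (t * t * t + 27 * (t * t) + 237 * t + 669)
  cube-doubling = solve-∀
  go : ∀ t → (10 + t) * (10 + t) * (10 + t) ≤ 2 ^ (10 + t)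
  go zero    = ≤ᵇ⇒≤ 1000 1024 _
  go (suc t) = ≤-trans (≤-trans (m≤m+n _ _) (≤-reflexive (sym (cube-doubling t)))) (*-monoʳ-≤ 2 (go t))

quadratic≤ : ∀ K a → 1 ≤ a → K * suc (a * (32 * a + K)) ≤ K * (33 + K) * (a * a)
quadratic≤ K (suc s) _ = ≤-trans (m≤m+n _ _) (≤-reflexive (sym (expand s K)))
  where
  expand : ∀ s K → K * (33 + K) * (suc s * suc s)
                 ≡ K * suc (suc s * (32 * suc s + K)) + K * ((s * s + 2 * s) + K * (s * s + s))
  expand = solve-∀

poly≤exp : ∀ K → ∃[ A₀ ] ∀ a → A₀ ≤ a → K * suc (a * (32 * a + K)) ≤ 2 ^ a
poly≤exp K = 10 + C , λ a A₀≤a → begin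
  K * suc (a * (32 * a + K)) ≤⟨ quadratic≤ K a (≤-trans (s≤s z≤n) A₀≤a) ⟩
  C * (a * a)                ≤⟨ *-monoˡ-≤ (a * a) (≤-trans (m≤n+m C 10) A₀≤a) ⟩
  a * (a * a)                ≡⟨ sym (*-assoc a a a) ⟩
  a * a * a                  ≤⟨ cube≤2^ a (≤-trans (m≤m+n 10 C) A₀≤a) ⟩
  2 ^ a                      ∎
  where
  open ≤-Reasoning
  C : ℕ
  C = K * (33 + K)

quotient-bracket : ∀ n a .{{_ : NonZero a}} → ∃[ b ] a * b < suc n × suc n ≤ suc b * a
quotient-bracket n a = n / a , s≤s a*b≤n , n<[1+b]a
  where
  a*b≤n : a * (n / a) ≤ n
  a*b≤n = ≤-trans (≤-reflexive (*-comm a (n / a))) (m/n*n≤m n a)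
  n<[1+b]a : suc n ≤ suc (n / a) * a
  n<[1+b]a = subst (λ m → suc m ≤ suc (n / a) * a) (sym (m≡m%n+[m/n]*n n a))
                   (+-monoˡ-≤ ((n / a) * a) (m%n<n n a))

large-quotient : ∀ K n a B .{{_ : NonZero a}} → a * (32 * a + K) ≤ n → n ≤ B * a → 32 * n ≤ B * B × K ≤ B
large-quotient K n a B Qa≤n n≤Ba = 32n≤B² , K≤B
  where
  open ≤-Reasoning
  instance
    a*a≢0 : NonZero (a * a)
    a*a≢0 = m*n≢0 a a
  32a²≤n : 32 * a * a ≤ n
  32a²≤n = begin
    32 * a * a         ≡⟨ *-comm (32 * a) a ⟩
    a * (32 * a)       ≤⟨ *-monoʳ-≤ a (m≤m+n (32 * a) K) ⟩
    a * (32 * a + K)   ≤⟨ Qa≤n ⟩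
    n                  ∎
  32n≤B² : 32 * n ≤ B * B
  32n≤B² = *-cancelʳ-≤ (32 * n) (B * B) (a * a) (begin
    32 * n * (a * a)   ≡⟨ regroup n a ⟩
    n * (32 * a * a)   ≤⟨ *-monoʳ-≤ n 32a²≤n ⟩
    n * n              ≤⟨ *-mono-≤ n≤Ba n≤Ba ⟩
    B * a * (B * a)    ≡⟨ square-product B a ⟩
    B * B * (a * a)    ∎)
    where
    regroup : ∀ n a → 32 * n * (a * a) ≡ n * (32 * a * a)
    regroup = solve-∀
    square-product : ∀ b a → b * a * (b * a) ≡ b * b * (a * a)
    square-product = solve-∀
  K≤B : K ≤ B
  K≤B = *-cancelʳ-≤ K B a (begin
    K * a              ≡⟨ *-comm K a ⟩
    a * K              ≤⟨ *-monoʳ-≤ a (m≤n+m K (32 * a)) ⟩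
    a * (32 * a + K)   ≤⟨ Qa≤n ⟩
    n                  ≤⟨ n≤Ba ⟩
    B * a              ∎)

-- Markov's inequality for both terms: c ≤ f (n+1)/P + T and T ≤ f nb/BB, and each of
-- K f (n+1)/P and K T is less than f/2.
two-term-bound : ∀ K c f n nb BB P T → P * c ≤ f * suc n + P * T → BB * T ≤ f * nb →
                 2 * K * suc n ≤ P → 2 * K * nb < BB → 0 < f → 0 < P → K * c < f
two-term-bound K c f n nb BB P T c-bound T-bound P-large BB-large f>0 P>0 =
  *-cancelˡ-< (2 * BB * P) (K * c) f (begin-strict
    2 * BB * P * (K * c)                              ≡⟨ e₁ K c BB P ⟩
    2 * K * (BB * (P * c))                            ≤⟨ *-monoʳ-≤ (2 * K) (*-monoʳ-≤ BB c-bound) ⟩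
    2 * K * (BB * (f * suc n + P * T))                ≡⟨ e₂ K BB f n P T ⟩
    BB * f * (2 * K * suc n) + P * (2 * K) * (BB * T) ≤⟨ +-mono-≤ (*-monoʳ-≤ (BB * f) P-large) (*-monoʳ-≤ (P * (2 * K)) T-bound) ⟩
    BB * f * P + P * (2 * K) * (f * nb)               ≡⟨ cong (BB * f * P +_) (e₃ P K f nb) ⟩
    BB * f * P + P * f * (2 * K * nb)                 <⟨ +-monoʳ-< (BB * f * P) (*-monoʳ-< (P * f) {{Pf≢0}} BB-large) ⟩
    BB * f * P + P * f * BB                           ≡⟨ e₄ BB f P ⟩
    2 * BB * P * f                                    ∎)
  where
  open ≤-Reasoning
  Pf≢0 : NonZero (P * f)
  Pf≢0 = >-nonZero (*-mono-≤ P>0 f>0)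
  e₁ : ∀ K c BB P → 2 * BB * P * (K * c) ≡ 2 * K * (BB * (P * c))
  e₁ = solve-∀
  e₂ : ∀ K BB f n P T → 2 * K * (BB * (f * suc n + P * T)) ≡ BB * f * (2 * K * suc n) + P * (2 * K) * (BB * T)
  e₂ = solve-∀
  e₃ : ∀ P K f nb → P * (2 * K) * (f * nb) ≡ P * f * (2 * K * nb)
  e₃ = solve-∀
  e₄ : ∀ BB f P → BB * f * P + P * f * BB ≡ 2 * BB * P * f
  e₄ = solve-∀

record Parameters (K n : ℕ) : Set where
  field
    a b                : ℕ
    a*b<n              : a * b < n
    2K[1+n]≤2^[1+a]    : 2 * K * suc n ≤ 2 ^ suc a
    2Kn^[1+b]<[1+b]!² : 2 * K * n ^ suc b < suc b ! * suc b !

-- a = ⌊log₂ 2K(n+1)⌋ and b = ⌊(n-1)/a⌋.  Beyond A₀, 2 ^ a ≤ 2K(n+1) forces a(32a + 2K) ≤ n,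
-- which makes b + 1 ≥ 32a and b + 1 ≥ 2K, as needed for K*n^b<b!*b!.
parameters-exist : ∀ K .{{_ : NonZero K}} → ∃[ N ] ∀ n → N ≤ n → Parameters K n
parameters-exist K = suc (Q A₀) , parameters
  where
  K′ : ℕ
  K′ = 2 * K
  Q : ℕ → ℕ
  Q a = a * (32 * a + K′)
  A₀ : ℕ
  A₀ = proj₁ (poly≤exp K′)
  2≤K′ : 2 ≤ K′
  2≤K′ = *-monoʳ-≤ 2 (>-nonZero⁻¹ K)
  parameters : ∀ n → suc (Q A₀) ≤ n → Parameters K n
  parameters zero    ()
  parameters (suc n) N≤n = from-log₂ (log₂-bracket m (≤-trans (s≤s z≤n) 2≤m))
    where
    m : ℕ
    m = K′ * suc (suc n)
    2≤m : 2 ≤ m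
    2≤m = ≤-trans 2≤K′ (m≤m*n K′ (suc (suc n)))
    Q≤n : ∀ a → 2 ^ a ≤ m → Q a ≤ suc n
    Q≤n a 2^a≤m with A₀ ≤? a
    ... | yes A₀≤a = ≤-pred (*-cancelˡ-≤ K′ {{>-nonZero (≤-trans (s≤s z≤n) 2≤K′)}}
                              (≤-trans (proj₂ (poly≤exp K′) a A₀≤a) 2^a≤m))
    ... | no  A₀≰a = ≤-trans (*-mono-≤ a≤A₀ (+-monoˡ-≤ K′ (*-monoʳ-≤ 32 a≤A₀))) (≤-trans (n≤1+n (Q A₀)) N≤n)
      where
      a≤A₀ : a ≤ A₀
      a≤A₀ = <⇒≤ (≰⇒> A₀≰a)
    from-log₂ : ∃[ a ] 2 ^ a ≤ m × m < 2 ^ suc a → Parameters K (suc n)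
    from-log₂ (zero   , _      , m<2)        = ⊥-elim (<⇒≱ m<2 2≤m)
    from-log₂ (suc a′ , 2^a≤m , m<2^[1+a]) = record
      { a = suc a′ ; b = b ; a*b<n = a*b<n
      ; 2K[1+n]≤2^[1+a] = <⇒≤ m<2^[1+a]
      ; 2Kn^[1+b]<[1+b]!² =
          K*n^b<b!*b! (suc b) K′ (suc n) (s≤s z≤n) 32n≤B² (<-≤-trans (n<2^n K′) (^-monoʳ-≤ 2 K′≤B)) }
      where
      b : ℕ
      b = proj₁ (quotient-bracket n (suc a′))
      a*b<n : suc a′ * b < suc n
      a*b<n = proj₁ (proj₂ (quotient-bracket n (suc a′)))
      large : 32 * suc n ≤ suc b * suc b × K′ ≤ suc b
      large = large-quotient K′ (suc n) (suc a′) (suc b) (Q≤n (suc a′) 2^a≤m) (proj₂ (proj₂ (quotient-bracket n (suc a′))))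
      32n≤B² : 32 * suc n ≤ suc b * suc b
      32n≤B² = proj₁ large
      K′≤B : K′ ≤ suc b
      K′≤B = proj₂ large

-- Schensted insertion without lateral bumps

ltrMinima : ℕ → List ℕ → ℕ
ltrMinima v []       = 0
ltrMinima v (x ∷ xs) = if x <ᵇ v then suc (ltrMinima x xs) else ltrMinima v xs

runningMin : ℕ → List ℕ → ℕ
runningMin v []       = v
runningMin v (y ∷ ys) = runningMin (if y <ᵇ v then y else v) ys

ltrMinima-∷ʳ : ∀ v xs x → ltrMinima v (xs ++ [ x ]) ≡ ltrMinima v xs + 𝟙 (x <ᵇ runningMin v xs)
ltrMinima-∷ʳ v []       x with x <ᵇ v
... | true  = refl
... | false = refl
ltrMinima-∷ʳ v (y ∷ ys) x with y <ᵇ v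
... | true  = cong suc (ltrMinima-∷ʳ y ys x)
... | false = ltrMinima-∷ʳ v ys x

ltrMinima-mono-∷ʳ : ∀ v xs x → ltrMinima v xs ≤ ltrMinima v (xs ++ [ x ])
ltrMinima-mono-∷ʳ v xs x rewrite ltrMinima-∷ʳ v xs x = m≤m+n _ _

runningMin-∷ʳ : ∀ v xs x → runningMin v (xs ++ [ x ]) ≡ (if x <ᵇ runningMin v xs then x else runningMin v xs)
runningMin-∷ʳ v []       x = refl
runningMin-∷ʳ v (y ∷ ys) x = runningMin-∷ʳ _ ys x

-- IncSubseq lo k hi w: w has a weakly increasing subsequence of length k with entries in
-- [lo, hi]; numIncSubseqs lo k w counts those with entries ≥ lo.
data IncSubseq : ℕ → ℕ → ℕ → List ℕ → Set where
  done : ∀ {lo hi w} → IncSubseq lo 0 hi w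
  skip : ∀ {lo k hi a w} → IncSubseq lo k hi w → IncSubseq lo k hi (a ∷ w)
  take : ∀ {lo k hi a w} → lo ≤ a → a ≤ hi → IncSubseq a k hi w → IncSubseq lo (suc k) hi (a ∷ w)

numIncSubseqs : ℕ → ℕ → List ℕ → ℕ
numIncSubseqs lo zero    w       = 1
numIncSubseqs lo (suc k) []      = 0
numIncSubseqs lo (suc k) (a ∷ w) = numIncSubseqs lo (suc k) w + (if lo ≤ᵇ a then numIncSubseqs a k w else 0)

IncSubseq-++ : ∀ {lo k hi w} ys → IncSubseq lo k hi w → IncSubseq lo k hi (w ++ ys)
IncSubseq-++ ys done         = done
IncSubseq-++ ys (skip p)     = skip (IncSubseq-++ ys p)
IncSubseq-++ ys (take l h p) = take l h (IncSubseq-++ ys p)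

IncSubseq-last : ∀ {lo x} w → lo ≤ x → IncSubseq lo 1 x (w ++ [ x ])
IncSubseq-last []      lo≤x = take lo≤x ≤-refl done
IncSubseq-last (_ ∷ w) lo≤x = skip (IncSubseq-last w lo≤x)

IncSubseq-extend : ∀ {lo k hi w x} → IncSubseq lo k hi w → hi ≤ x → lo ≤ x → IncSubseq lo (suc k) x (w ++ [ x ])
IncSubseq-extend {w = w} done       hi≤x lo≤x = IncSubseq-last w lo≤x
IncSubseq-extend (skip p)           hi≤x lo≤x = skip (IncSubseq-extend p hi≤x lo≤x)
IncSubseq-extend (take lo≤a a≤hi p) hi≤x lo≤x =
  take lo≤a (≤-trans a≤hi hi≤x) (IncSubseq-extend p hi≤x (≤-trans a≤hi hi≤x))

IncSubseq⇒numIncSubseqs>0 : ∀ {lo k hi w} → IncSubseq lo k hi w → 1 ≤ numIncSubseqs lo k w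
IncSubseq⇒numIncSubseqs>0 done = ≤-refl
IncSubseq⇒numIncSubseqs>0 {k = zero}  (skip p) = ≤-refl
IncSubseq⇒numIncSubseqs>0 {k = suc k} (skip p) = ≤-trans (IncSubseq⇒numIncSubseqs>0 p) (m≤m+n _ _)
IncSubseq⇒numIncSubseqs>0 {lo} {suc k} (take {a = a} {w = w} lo≤a _ p)
  with lo ≤ᵇ a | ≤ᵇ-reflects-≤ lo a
... | true  | _        = ≤-trans (IncSubseq⇒numIncSubseqs>0 p) (m≤n+m _ (numIncSubseqs lo (suc k) w))
... | false | ofⁿ lo≰a = ⊥-elim (lo≰a lo≤a)

size : List (List ℕ) → ℕ
size = sumOver length

firstRowLength : List (List ℕ) → ℕ
firstRowLength []      = 0
firstRowLength (r ∷ _) = length r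

DecreasingBelow : ℕ → List (List ℕ) → Set
DecreasingBelow p []       = ⊤
DecreasingBelow p (r ∷ rs) = length r ≤ p × DecreasingBelow (length r) rs

DecreasingBelow-weaken : ∀ {p q} rs → p ≤ q → DecreasingBelow p rs → DecreasingBelow q rs
DecreasingBelow-weaken []      p≤q _           = tt
DecreasingBelow-weaken (_ ∷ _) p≤q (r≤p , rs) = ≤-trans r≤p p≤q , rs

size≤length*bound : ∀ p rs → DecreasingBelow p rs → size rs ≤ length rs * p
size≤length*bound p []       _          = z≤n
size≤length*bound p (r ∷ rs) (r≤p , d) =
  +-mono-≤ r≤p (≤-trans (size≤length*bound (length r) rs d) (*-monoʳ-≤ (length rs) r≤p))

CornerBelowMin : ℕ → List ℕ → List (List ℕ) → Set
CornerBelowMin v w []            = w ≡ []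
CornerBelowMin v w ([] ∷ _)      = ⊥
CornerBelowMin v w ((h ∷ _) ∷ _) = h ≤ runningMin v w

EndsIncSubseqs : ℕ → List ℕ → List ℕ → Set
EndsIncSubseqs k w []       = ⊤
EndsIncSubseqs k w (e ∷ es) = IncSubseq 0 (suc k) e w × EndsIncSubseqs (suc k) w es

BottomRowWitnessed : List ℕ → List (List ℕ) → Set
BottomRowWitnessed w []      = ⊤
BottomRowWitnessed w (r ∷ _) = EndsIncSubseqs 0 w r

record Invariant (v : ℕ) (w : List ℕ) (t : List (List ℕ)) : Set where
  field
    decreasing       : DecreasingBelow (firstRowLength t) t
    size≡length      : size t ≡ length w
    height≤ltrMinima : length t ≤ ltrMinima v w
    cornerBelowMin   : CornerBelowMin v w t
    bottomRow        : BottomRowWitnessed w t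

EndsIncSubseqs-weaken : ∀ k w ys r → EndsIncSubseqs k w r → EndsIncSubseqs k (w ++ ys) r
EndsIncSubseqs-weaken k w ys []       _        = tt
EndsIncSubseqs-weaken k w ys (e ∷ es) (p , ps) = IncSubseq-++ ys p , EndsIncSubseqs-weaken (suc k) w ys es ps

EndsIncSubseqs-rowIns : ∀ k w r x p → EndsIncSubseqs k w r → IncSubseq 0 k p w → p ≤ x →
                        EndsIncSubseqs k (w ++ [ x ]) (proj₁ (rowIns x r))
EndsIncSubseqs-rowIns k w []       x p _  ip p≤x = IncSubseq-extend ip p≤x z≤n , tt
EndsIncSubseqs-rowIns k w (y ∷ ys) x p (py , pys) ip p≤x with x <ᵇ y | <ᵇ-reflects-< x y
... | true  | _        = IncSubseq-extend ip p≤x z≤n , EndsIncSubseqs-weaken (suc k) w [ x ] ys pys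
... | false | ofⁿ x≮y with rowIns x ys | EndsIncSubseqs-rowIns (suc k) w ys x y pys py (≮⇒≥ x≮y)
...   | _ , _ , _ | ih = IncSubseq-++ [ x ] py , ih

RowInsSpec : List ℕ → List ℕ → ℕ → Maybe ℕ → Set
RowInsSpec r r' c nothing  = length r' ≡ suc (length r) × c ≡ length r
RowInsSpec r r' c (just y) = length r' ≡ length r × c < length r

rowIns-spec : ∀ x r {r' c m} → rowIns x r ≡ (r' , c , m) → RowInsSpec r r' c m
rowIns-spec x []       refl = refl , refl
rowIns-spec x (y ∷ ys) eq with x <ᵇ y
rowIns-spec x (y ∷ ys) refl | true = refl , s≤s z≤n
rowIns-spec x (y ∷ ys) eq   | false with rowIns x ys in e
rowIns-spec x (y ∷ ys) refl | false | _ , _ , nothing with rowIns-spec x ys e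
... | len , col = cong suc len , cong suc col
rowIns-spec x (y ∷ ys) refl | false | _ , _ , just _ with rowIns-spec x ys e
... | len , col = cong suc len , s≤s col

rowIns-col0 : ∀ {x h hs r' y} → rowIns x (h ∷ hs) ≡ (r' , 0 , just y) → x < h
rowIns-col0 {x} {h} {hs} eq with x <ᵇ h | <ᵇ-reflects-< x h
... | true  | ofʸ x<h = x<h
... | false | _ with rowIns x hs
rowIns-col0 () | false | _ | _ , _ , _

rowIns-head : ∀ {x h hs r' c m} → rowIns x (h ∷ hs) ≡ (r' , c , m) →
              Σ[ tl ∈ List ℕ ] r' ≡ (if x <ᵇ h then x else h) ∷ tl
rowIns-head {x} {h} {hs} eq with x <ᵇ h
rowIns-head refl | true = _ , refl
rowIns-head {x} {h} {hs} eq | false with rowIns x hs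
rowIns-head refl | false | _ , _ , _ = _ , refl

if<ᵇ-mono : ∀ x {h m} → h ≤ m → (if x <ᵇ h then x else h) ≤ (if x <ᵇ m then x else m)
if<ᵇ-mono x {h} {m} h≤m with x <ᵇ h | <ᵇ-reflects-< x h | x <ᵇ m | <ᵇ-reflects-< x m
... | true  | _        | true  | _        = ≤-refl
... | true  | ofʸ x<h  | false | ofⁿ x≮m = ⊥-elim (x≮m (<-≤-trans x<h h≤m))
... | false | ofⁿ x≮h  | true  | _        = ≮⇒≥ x≮h
... | false | _        | false | _        = h≤m

insRows-size : ∀ src x rs → size (proj₁ (insRows src x rs)) ≡ suc (size rs)
insRows-size src x [] = refl
insRows-size src x (r ∷ rs) with rowIns x r in e
... | r' , c , nothing = cong (_+ size rs) (proj₁ (rowIns-spec x r e))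
... | r' , c , just y with insRows (just c) y rs | insRows-size (just c) y rs
...   | rs' , b | ih rewrite proj₁ (rowIns-spec x r e) | ih = +-suc (length r) (size rs)

insRows-height : ∀ src x rs → length (proj₁ (insRows src x rs)) ≤ suc (length rs)
insRows-height src x [] = ≤-refl
insRows-height src x (r ∷ rs) with rowIns x r
... | r' , c , nothing = n≤1+n _
... | r' , c , just y with insRows (just c) y rs | insRows-height (just c) y rs
...   | rs' , b | ih = s≤s ih

length-∷ʳ : ∀ (w : List ℕ) x → length (w ++ [ x ]) ≡ suc (length w)
length-∷ʳ w x = trans (length-++ w) (+-comm (length w) 1)

-- A vertical bump lands in the column it left, so the rows above stay decreasing, and a new
-- row is only opened if the chain of bumps started in column 0.
insRows-vertical : ∀ j x rs p → DecreasingBelow p rs → j < p → proj₂ (insRows (just j) x rs) ≡ true →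
                   DecreasingBelow p (proj₁ (insRows (just j) x rs))
                   × (length (proj₁ (insRows (just j) x rs)) ≤ length rs ⊎ j ≡ 0)
insRows-vertical j x [] p _ j<p ok with ≡ᵇ-true⁻ {j} {0} ok
... | refl = (j<p , tt) , inj₂ refl
insRows-vertical j x (r ∷ rs) p (r≤p , d) j<p ok with rowIns x r in e
... | r' , c , nothing with rowIns-spec x r e | ≡ᵇ-true⁻ {j} {c} ok
...   | len , c≡r | refl rewrite len =
  (subst (λ z → suc z ≤ p) c≡r j<p , DecreasingBelow-weaken rs (n≤1+n _) d) , inj₁ ≤-refl
insRows-vertical j x (r ∷ rs) p (r≤p , d) j<p ok | r' , c , just y
  with insRows (just c) y rs in e₂ | rowIns-spec x r e | ∧-true⁻ {okBump (just j) c} ok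
... | rs' , b | len , c<r | j≡c , ok′
  with insRows-vertical c y rs (length r) d c<r (trans (cong proj₂ e₂) ok′)
... | d′ , grows rewrite e₂ | len = (r≤p , d′) , lift grows
  where
  lift : length rs' ≤ length rs ⊎ c ≡ 0 → suc (length rs') ≤ suc (length rs) ⊎ j ≡ 0
  lift (inj₁ le) = inj₁ (s≤s le)
  lift (inj₂ c≡0) = inj₂ (trans (≡ᵇ-true⁻ j≡c) c≡0)

Invariant-[] : ∀ v → Invariant v [] []
Invariant-[] v = record
  { decreasing = tt ; size≡length = refl ; height≤ltrMinima = z≤n ; cornerBelowMin = refl ; bottomRow = tt }

module _ {w : List ℕ} {x h : ℕ} {hs r' : List ℕ} {c : ℕ} {m : Maybe ℕ} (ins : rowIns x (h ∷ hs) ≡ (r' , c , m)) where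

  corner-rowIns : ∀ v → h ≤ runningMin v w → ∀ rs → CornerBelowMin v (w ++ [ x ]) (r' ∷ rs)
  corner-rowIns v h≤min rs with rowIns-head ins
  ... | _ , refl rewrite runningMin-∷ʳ v w x = if<ᵇ-mono x h≤min

  bottomRow-rowIns : EndsIncSubseqs 0 w (h ∷ hs) → EndsIncSubseqs 0 (w ++ [ x ]) r'
  bottomRow-rowIns ends =
    subst (λ z → EndsIncSubseqs 0 (w ++ [ x ]) (proj₁ z)) ins (EndsIncSubseqs-rowIns 0 w (h ∷ hs) x 0 ends done z≤n)

module _ {v : ℕ} {w : List ℕ} {x h : ℕ} {hs : List ℕ} {rs : List (List ℕ)} (inv : Invariant v w ((h ∷ hs) ∷ rs)) where

  open Invariant inv

  append-invariant : ∀ {r' c} → rowIns x (h ∷ hs) ≡ (r' , c , nothing) → Invariant v (w ++ [ x ]) (r' ∷ rs)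
  append-invariant {r'} ins = record
    { decreasing = ≤-refl , DecreasingBelow-weaken rs r≤r' (proj₂ decreasing)
    ; size≡length = trans (cong (_+ size rs) len) (trans (cong suc size≡length) (sym (length-∷ʳ w x)))
    ; height≤ltrMinima = ≤-trans height≤ltrMinima (ltrMinima-mono-∷ʳ v w x)
    ; cornerBelowMin = corner-rowIns ins v cornerBelowMin rs
    ; bottomRow = bottomRow-rowIns ins bottomRow }
    where
    len : length r' ≡ suc (length (h ∷ hs))
    len = proj₁ (rowIns-spec x (h ∷ hs) ins)
    r≤r' : length (h ∷ hs) ≤ length r'
    r≤r' = subst (length (h ∷ hs) ≤_) (sym len) (n≤1+n _)

  bump-invariant : ∀ {r' c y} → rowIns x (h ∷ hs) ≡ (r' , c , just y) → proj₂ (insRows (just c) y rs) ≡ true →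
                   Invariant v (w ++ [ x ]) (r' ∷ proj₁ (insRows (just c) y rs))
  bump-invariant {r'} {c} {y} ins ok with rowIns-spec x (h ∷ hs) ins
  ... | len , c<r with insRows-vertical c y rs (length (h ∷ hs)) (proj₂ decreasing) c<r ok
  ...   | decreasing′ , grows = record
    { decreasing = ≤-refl , subst (λ z → DecreasingBelow z rs') (sym len) decreasing′
    ; size≡length = trans (cong₂ _+_ len (insRows-size (just c) y rs))
                          (trans (+-suc _ (size rs)) (trans (cong suc size≡length) (sym (length-∷ʳ w x))))
    ; height≤ltrMinima = height grows
    ; cornerBelowMin = corner-rowIns ins v cornerBelowMin rs'
    ; bottomRow = bottomRow-rowIns ins bottomRow }
    where
    rs' : List (List ℕ)
    rs' = proj₁ (insRows (just c) y rs)
    height : length rs' ≤ length rs ⊎ c ≡ 0 → suc (length rs') ≤ ltrMinima v (w ++ [ x ])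
    height (inj₁ no-new-row) = ≤-trans (s≤s no-new-row) (≤-trans height≤ltrMinima (ltrMinima-mono-∷ʳ v w x))
    height (inj₂ refl) =
      ≤-trans (s≤s (insRows-height (just c) y rs)) (≤-trans (s≤s height≤ltrMinima) (≤-reflexive (sym new-minimum)))
      where
      new-minimum : ltrMinima v (w ++ [ x ]) ≡ suc (ltrMinima v w)
      new-minimum rewrite ltrMinima-∷ʳ v w x | <⇒<ᵇ≡true (<-≤-trans (rowIns-col0 ins) cornerBelowMin) =
        +-comm (ltrMinima v w) 1

step-invariant : ∀ v w t x → Invariant v w t → x < v → proj₂ (insRows nothing x t) ≡ true →
                 Invariant v (w ++ [ x ]) (proj₁ (insRows nothing x t))
step-invariant v w [] x inv x<v _ with Invariant.cornerBelowMin inv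
... | refl = record
  { decreasing = ≤-refl , tt ; size≡length = refl ; height≤ltrMinima = ≤-reflexive (sym minima)
  ; cornerBelowMin = ≤-reflexive (sym corner) ; bottomRow = take z≤n ≤-refl done , tt }
  where
  minima : ltrMinima v [ x ] ≡ 1
  minima rewrite <⇒<ᵇ≡true x<v = refl
  corner : runningMin v [ x ] ≡ x
  corner rewrite <⇒<ᵇ≡true x<v = refl
step-invariant v w ([] ∷ rs) x inv = ⊥-elim (Invariant.cornerBelowMin inv)
step-invariant v w ((h ∷ hs) ∷ rs) x inv x<v ok with rowIns x (h ∷ hs) in ins
... | r' , c , nothing = append-invariant inv ins
... | r' , c , just y  = bump-invariant inv ins ok

foldl-invariant : ∀ v w pre t b → All (_< v) w → (b ≡ true → Invariant v pre t) →
                  proj₂ (foldl step (t , b) w) ≡ true → Invariant v (pre ++ w) (proj₁ (foldl step (t , b) w))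
foldl-invariant v [] pre t b _ inv ok rewrite ++-identityʳ pre = inv ok
foldl-invariant v (x ∷ xs) pre t b (x<v ∷ xs<v) inv ok with insRows nothing x t in e
... | t' , b' = subst (λ z → Invariant v z (proj₁ (foldl step (t' , b ∧ b') xs))) (++-assoc pre [ x ] xs)
                  (foldl-invariant v xs (pre ++ [ x ]) t' (b ∧ b') xs<v inv′ ok)
  where
  inv′ : b ∧ b' ≡ true → Invariant v (pre ++ [ x ]) t'
  inv′ bb with ∧-true⁻ {b} bb
  ... | b≡true , b'≡true = subst (λ z → Invariant v (pre ++ [ x ]) (proj₁ z)) e
                             (step-invariant v pre t x (inv b≡true) x<v (trans (cong proj₂ e) b'≡true))

schensted-invariant : ∀ v w → All (_< v) w → NoLateral w → Invariant v w (proj₁ (schensted w))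
schensted-invariant v w w<v = foldl-invariant v w [] [] true w<v (λ _ → Invariant-[] v)

EndsIncSubseqs-long : ∀ k w r → EndsIncSubseqs k w r → ∀ n → k < n → n ≤ k + length r → 1 ≤ numIncSubseqs 0 n w
EndsIncSubseqs-long k w [] _ n k<n n≤k = ⊥-elim (<⇒≱ k<n (≤-trans n≤k (≤-reflexive (+-identityʳ k))))
EndsIncSubseqs-long k w (e ∷ es) (p , ps) n k<n n≤k with m≤n⇒m<n∨m≡n k<n
... | inj₂ refl = IncSubseq⇒numIncSubseqs>0 p
... | inj₁ k+1<n = EndsIncSubseqs-long (suc k) w es ps n k+1<n (≤-trans n≤k (≤-reflexive (+-suc k (length es))))

Invariant-dichotomy : ∀ {v w} t a b → Invariant v w t → a * b < length w →
                      suc a ≤ ltrMinima v w ⊎ 1 ≤ numIncSubseqs 0 (suc b) w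
Invariant-dichotomy {v} {w} t a b inv small with suc a ≤? ltrMinima v w | suc b ≤? firstRowLength t
... | yes many-minima | _ = inj₁ many-minima
... | no _ | yes long-row = inj₂ (bottomRow-long t bottomRow long-row)
  where
  open Invariant inv
  bottomRow-long : ∀ t → BottomRowWitnessed w t → suc b ≤ firstRowLength t → 1 ≤ numIncSubseqs 0 (suc b) w
  bottomRow-long (r ∷ _) ends long = EndsIncSubseqs-long 0 w r ends (suc b) (s≤s z≤n) long
... | no few-minima | no short-row = ⊥-elim (<⇒≱ small (begin
  length w                    ≡⟨ sym size≡length ⟩
  size t                      ≤⟨ size≤length*bound (firstRowLength t) t decreasing ⟩
  length t * firstRowLength t ≤⟨ *-mono-≤ (≤-trans height≤ltrMinima (≮⇒≥ few-minima)) (≮⇒≥ short-row) ⟩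
  a * b                       ∎))
  where
  open Invariant inv
  open ≤-Reasoning

noLateral-dichotomy : ∀ v w a b → All (_< v) w → NoLateral w → a * b < length w →
                      suc a ≤ ltrMinima v w ⊎ 1 ≤ numIncSubseqs 0 (suc b) w
noLateral-dichotomy v w a b w<v noLateral =
  Invariant-dichotomy (proj₁ (schensted w)) a b (schensted-invariant v w w<v noLateral)

-- Sums over arrangements

Subset : Set
Subset = ℕ → Bool

infixl 7 _∩_
infixl 8 _∖_

_∩_ : Subset → Subset → Subset
(B ∩ P) x = B x ∧ P x

_∖_ : Subset → ℕ → Subset
(B ∖ a) x = B x ∧ not (a ≡ᵇ x)

isArrangement : Subset → List ℕ → Bool
isArrangement B w = all B w ∧ does (unique? w)

all-∖ : ∀ B a w → all (B ∖ a) w ≡ all B w ∧ all (λ y → not (a ≡ᵇ y)) w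
all-∖ B a []       = refl
all-∖ B a (x ∷ xs) rewrite all-∖ B a xs with B x | a ≡ᵇ x
... | true  | true  = sym (∧-zeroʳ _)
... | true  | false = refl
... | false | _     = refl

unique?-∷ : ∀ a w → does (unique? (a ∷ w)) ≡ all (λ y → not (a ≡ᵇ y)) w ∧ does (unique? w)
unique?-∷ a w = cong (_∧ does (unique? w)) (all?≢ w)
  where
  all?≢ : ∀ w → does (All.all? (λ y → ¬? (a ≟ y)) w) ≡ all (λ y → not (a ≡ᵇ y)) w
  all?≢ []       = refl
  all?≢ (y ∷ ys) = cong (not (a ≡ᵇ y) ∧_) (all?≢ ys)

isArrangement-∷ : ∀ B a w → isArrangement B (a ∷ w) ≡ B a ∧ isArrangement (B ∖ a) w
isArrangement-∷ B a w = begin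
  (B a ∧ all B w) ∧ does (unique? (a ∷ w)) ≡⟨ cong ((B a ∧ all B w) ∧_) (unique?-∷ a w) ⟩
  (B a ∧ all B w) ∧ (notIn ∧ unique)       ≡⟨ ∧-assoc (B a) (all B w) (notIn ∧ unique) ⟩
  B a ∧ (all B w ∧ (notIn ∧ unique))       ≡⟨ cong (B a ∧_) (sym (∧-assoc (all B w) notIn unique)) ⟩
  B a ∧ ((all B w ∧ notIn) ∧ unique)       ≡⟨ cong (λ z → B a ∧ (z ∧ unique)) (sym (all-∖ B a w)) ⟩
  B a ∧ (all (B ∖ a) w ∧ unique)           ∎
  where
  open ≡-Reasoning
  notIn unique : Bool
  notIn  = all (λ y → not (a ≡ᵇ y)) w
  unique = does (unique? w)

module Arrangements (A : List ℕ) (A-unique : Unique A) (U : ℕ) (A<U : All (_< U) A) where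

  ∑ᴮ : Subset → (ℕ → ℕ) → ℕ
  ∑ᴮ B f = ∑[ a ∈ A ] (if B a then f a else 0)

  syntax ∑ᴮ B (λ a → e) = ∑ᴮ[ a ∈ B ] e

  # : Subset → ℕ
  # B = ∑ᴮ[ _ ∈ B ] 1

  below atLeast : Subset → ℕ → ℕ
  below   B v = # (B ∩ (_<ᵇ v))
  atLeast B v = # (B ∩ (v ≤ᵇ_))

  ∑ᴮ-congˡ : ∀ {B C} f → (∀ a → B a ≡ C a) → ∑ᴮ B f ≡ ∑ᴮ C f
  ∑ᴮ-congˡ f B≗C = sumOver-cong (λ a → cong (λ b → if b then f a else 0) (B≗C a)) A

  ∑ᴮ-congʳ : ∀ B {f g} → (∀ a → B a ≡ true → f a ≡ g a) → ∑ᴮ B f ≡ ∑ᴮ B g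
  ∑ᴮ-congʳ B f≗g = sumOver-cong pointwise A
    where
    pointwise : ∀ a → (if B a then _ else 0) ≡ (if B a then _ else 0)
    pointwise a with B a in Ba
    ... | true  = f≗g a Ba
    ... | false = refl

  ∑ᴮ-mono : ∀ B {f g} → (∀ a → a ∈ A → B a ≡ true → f a ≤ g a) → ∑ᴮ B f ≤ ∑ᴮ B g
  ∑ᴮ-mono B f≤g = sumOver-monoᴬ (tabulate (λ a∈A → a∈A)) pointwise
    where
    pointwise : ∀ {a} → a ∈ A → (if B a then _ else 0) ≤ (if B a then _ else 0)
    pointwise {a} a∈A with B a in Ba
    ... | true  = f≤g a a∈A Ba
    ... | false = z≤n

  ∑ᴮ-+ : ∀ B f g → ∑ᴮ[ a ∈ B ] (f a + g a) ≡ ∑ᴮ B f + ∑ᴮ B g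
  ∑ᴮ-+ B f g = trans (sumOver-cong pointwise A) (sumOver-+ _ _ A)
    where
    pointwise : ∀ a → (if B a then f a + g a else 0) ≡ (if B a then f a else 0) + (if B a then g a else 0)
    pointwise a with B a
    ... | true  = refl
    ... | false = refl

  ∑ᴮ-*ˡ : ∀ B c f → ∑ᴮ[ a ∈ B ] (c * f a) ≡ c * ∑ᴮ B f
  ∑ᴮ-*ˡ B c f = trans (sumOver-cong pointwise A) (sumOver-*ˡ c _ A)
    where
    pointwise : ∀ a → (if B a then c * f a else 0) ≡ c * (if B a then f a else 0)
    pointwise a with B a
    ... | true  = refl
    ... | false = sym (*-zeroʳ c)

  ∑ᴮ-const : ∀ B c → ∑ᴮ[ _ ∈ B ] c ≡ # B * c
  ∑ᴮ-const B c = trans (∑ᴮ-congʳ B (λ _ _ → sym (*-identityʳ c)))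
                       (trans (∑ᴮ-*ˡ B c (λ _ → 1)) (*-comm c (# B)))

  ∑ᴮ-∅ : ∀ B f → (∀ a → a ∈ A → B a ≡ false) → ∑ᴮ B f ≡ 0
  ∑ᴮ-∅ B f empty = trans (sumOver-congᴬ (tabulate (λ a∈A → a∈A)) pointwise) (sumOver-0 A)
    where
    pointwise : ∀ {a} → a ∈ A → (if B a then f a else 0) ≡ 0
    pointwise {a} a∈A rewrite empty a a∈A = refl

  ∑ᴮ-split : ∀ B P f → ∑ᴮ B f ≡ ∑ᴮ (B ∩ P) f + ∑ᴮ (B ∩ (not ∘ P)) f
  ∑ᴮ-split B P f = trans (sumOver-cong pointwise A) (sumOver-+ _ _ A)
    where
    pointwise : ∀ a → (if B a then f a else 0) ≡ (if B a ∧ P a then f a else 0) + (if B a ∧ not (P a) then f a else 0)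
    pointwise a with B a | P a
    ... | true  | true  = sym (+-identityʳ (f a))
    ... | true  | false = refl
    ... | false | _     = refl

  ∑ᴮ-∨ : ∀ B P Q f → (∀ a → P a ∧ Q a ≡ false) →
         ∑ᴮ (B ∩ (λ a → P a ∨ Q a)) f ≡ ∑ᴮ (B ∩ P) f + ∑ᴮ (B ∩ Q) f
  ∑ᴮ-∨ B P Q f disjoint = trans (sumOver-cong pointwise A) (sumOver-+ _ _ A)
    where
    pointwise : ∀ a → (if B a ∧ (P a ∨ Q a) then f a else 0)
                    ≡ (if B a ∧ P a then f a else 0) + (if B a ∧ Q a then f a else 0)
    pointwise a with B a | P a | Q a | disjoint a
    ... | false | _     | _     | _  = refl
    ... | true  | true  | false | _  = sym (+-identityʳ (f a))
    ... | true  | false | _     | _  = refl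

  ∑ᴮ-∖ : ∀ B f {a} → a ∈ A → B a ≡ true → ∑ᴮ B f ≡ f a + ∑ᴮ (B ∖ a) f
  ∑ᴮ-∖ B f {a} a∈A Ba = begin
    ∑ᴮ B f
      ≡⟨ sumOver-cong pointwise A ⟩
    ∑[ x ∈ A ] ((if a ≡ᵇ x then g x else 0) + (if (B ∖ a) x then f x else 0))
      ≡⟨ sumOver-+ _ _ A ⟩
    ∑[ x ∈ A ] (if a ≡ᵇ x then g x else 0) + ∑ᴮ (B ∖ a) f
      ≡⟨ cong (_+ ∑ᴮ (B ∖ a) f) (sumOver-point g A A-unique a∈A) ⟩
    g a + ∑ᴮ (B ∖ a) f
      ≡⟨ cong (λ b → (if b then f a else 0) + ∑ᴮ (B ∖ a) f) Ba ⟩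
    f a + ∑ᴮ (B ∖ a) f
      ∎
    where
    open ≡-Reasoning
    g : ℕ → ℕ
    g x = if B x then f x else 0
    pointwise : ∀ x → g x ≡ (if a ≡ᵇ x then g x else 0) + (if (B ∖ a) x then f x else 0)
    pointwise x with B x | a ≡ᵇ x
    ... | true  | true  = sym (+-identityʳ (f x))
    ... | true  | false = refl
    ... | false | true  = refl
    ... | false | false = refl

  ∑ᴮ-single : ∀ B f v → ∑ᴮ (B ∩ (v ≡ᵇ_)) f ≡ # (B ∩ (v ≡ᵇ_)) * f v
  ∑ᴮ-single B f v = trans (∑ᴮ-congʳ (B ∩ (v ≡ᵇ_)) at-v) (∑ᴮ-const (B ∩ (v ≡ᵇ_)) (f v))
    where
    at-v : ∀ a → (B ∩ (v ≡ᵇ_)) a ≡ true → f a ≡ f v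
    at-v a member = cong f (sym (≡ᵇ-true⁻ (proj₂ (∧-true⁻ {B a} member))))

  #-single≤1 : ∀ B v → # (B ∩ (v ≡ᵇ_)) ≤ 1
  #-single≤1 B v = ≤-trans (sumOver-mono drop-B A) at-most-once
    where
    drop-B : ∀ a → (if B a ∧ (v ≡ᵇ a) then 1 else 0) ≤ 𝟙 (v ≡ᵇ a)
    drop-B a with B a
    ... | true  = ≤-refl
    ... | false = z≤n
    at-most-once : ∑[ a ∈ A ] 𝟙 (v ≡ᵇ a) ≤ 1
    at-most-once with v ∈? A
    ... | yes v∈A = ≤-reflexive (sumOver-point (λ _ → 1) A A-unique v∈A)
    ... | no  v∉A = ≤-trans (≤-reflexive (sumOver-absent (λ _ → 1) A (All.¬Any⇒All¬ A v∉A))) z≤n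

  #-∖ : ∀ B {a} → a ∈ A → B a ≡ true → # B ≡ suc (# (B ∖ a))
  #-∖ B = ∑ᴮ-∖ B (λ _ → 1)

  #∩-∖ : ∀ B P {a} → a ∈ A → B a ≡ true → P a ≡ true → # (B ∩ P) ≡ suc (# (B ∖ a ∩ P))
  #∩-∖ B P {a} a∈A Ba Pa = trans (#-∖ (B ∩ P) a∈A (cong₂ _∧_ Ba Pa)) (cong suc (∑ᴮ-congˡ _ reorder))
    where
    reorder : ∀ x → (B x ∧ P x) ∧ not (a ≡ᵇ x) ≡ (B x ∧ not (a ≡ᵇ x)) ∧ P x
    reorder x with B x
    ... | true  = ∧-comm (P x) _
    ... | false = refl

  #∩-∖-≤ : ∀ B P a → # (B ∖ a ∩ P) ≤ # (B ∩ P)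
  #∩-∖-≤ B P a = sumOver-mono pointwise A
    where
    pointwise : ∀ x → 𝟙 ((B x ∧ not (a ≡ᵇ x)) ∧ P x) ≤ 𝟙 (B x ∧ P x)
    pointwise x with B x | a ≡ᵇ x
    ... | true  | true  = z≤n
    ... | true  | false = ≤-refl
    ... | false | _     = z≤n

  below-∖ : ∀ B a → below (B ∖ a) a ≡ below B a
  below-∖ B a = ∑ᴮ-congˡ _ pointwise
    where
    pointwise : ∀ x → (B x ∧ not (a ≡ᵇ x)) ∧ (x <ᵇ a) ≡ B x ∧ (x <ᵇ a)
    pointwise x with B x | x <ᵇ a | a ≡ᵇ x | <ᵇ-∧-≡ᵇ x a
    ... | false | _     | _     | _  = refl
    ... | true  | true  | false | _  = refl
    ... | true  | false | true  | _  = refl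
    ... | true  | false | false | _  = refl

  atLeast-∖ : ∀ B a → atLeast (B ∖ a) a ≡ atLeast B (suc a)
  atLeast-∖ B a = ∑ᴮ-congˡ _ pointwise
    where
    pointwise : ∀ x → (B x ∧ not (a ≡ᵇ x)) ∧ (a ≤ᵇ x) ≡ B x ∧ (a <ᵇ x)
    pointwise x rewrite ≤ᵇ-split a x with B x | a <ᵇ x | a ≡ᵇ x | <ᵇ-∧-≡ᵇ′ a x
    ... | false | _     | _     | _  = refl
    ... | true  | true  | false | _  = refl
    ... | true  | false | true  | _  = refl
    ... | true  | false | false | _  = refl

  ∑ᴮ-<ᵇ-suc : ∀ B v f → ∑ᴮ (B ∩ (_<ᵇ suc v)) f ≡ ∑ᴮ (B ∩ (_<ᵇ v)) f + ∑ᴮ (B ∩ (v ≡ᵇ_)) f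
  ∑ᴮ-<ᵇ-suc B v f = trans (∑ᴮ-congˡ f (λ a → cong (B a ∧_) (<ᵇ-suc a v)))
                          (∑ᴮ-∨ B (_<ᵇ v) (v ≡ᵇ_) f (λ a → <ᵇ-∧-≡ᵇ a v))

  ∑ᴮ-≤ᵇ : ∀ B v f → ∑ᴮ (B ∩ (v ≤ᵇ_)) f ≡ ∑ᴮ (B ∩ (suc v ≤ᵇ_)) f + ∑ᴮ (B ∩ (v ≡ᵇ_)) f
  ∑ᴮ-≤ᵇ B v f = trans (∑ᴮ-congˡ f (λ a → cong (B a ∧_) (≤ᵇ-split v a)))
                      (∑ᴮ-∨ B (v <ᵇ_) (v ≡ᵇ_) f (λ a → <ᵇ-∧-≡ᵇ′ v a))

  ∑ᴮ-rank-below : ∀ B h v → ∑ᴮ[ a ∈ B ∩ (_<ᵇ v) ] h (below B a) ≡ ∑[ j < below B v ] h j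
  ∑ᴮ-rank-below B h zero =
    trans (∑ᴮ-∅ _ _ none) (cong (λ M → ∑[ j < M ] h j) (sym (∑ᴮ-∅ _ _ none)))
    where
    none : ∀ a → a ∈ A → B a ∧ (a <ᵇ 0) ≡ false
    none a _ = ∧-zeroʳ (B a)
  ∑ᴮ-rank-below B h (suc v) = begin
    ∑ᴮ (B ∩ (_<ᵇ suc v)) g                      ≡⟨ ∑ᴮ-<ᵇ-suc B v g ⟩
    ∑ᴮ (B ∩ (_<ᵇ v)) g + ∑ᴮ (B ∩ (v ≡ᵇ_)) g     ≡⟨ cong₂ _+_ (∑ᴮ-rank-below B h v) (∑ᴮ-single B g v) ⟩
    ∑[ j < below B v ] h j + c * h (below B v) ≡⟨ sumBelow-extend h (below B v) c (#-single≤1 B v) ⟩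
    ∑[ j < below B v + c ] h j                 ≡⟨ cong (λ M → ∑[ j < M ] h j) (sym (∑ᴮ-<ᵇ-suc B v (λ _ → 1))) ⟩
    ∑[ j < below B (suc v) ] h j               ∎
    where
    open ≡-Reasoning
    g : ℕ → ℕ
    g a = h (below B a)
    c : ℕ
    c = # (B ∩ (v ≡ᵇ_))

  ∑ᴮ-rank-atLeast : ∀ B h v → ∑ᴮ[ a ∈ B ∩ (v ≤ᵇ_) ] h (atLeast B (suc a)) ≡ ∑[ j < atLeast B v ] h j
  ∑ᴮ-rank-atLeast B h v = go U v (m≤m+n U v)
    where
    g : ℕ → ℕ
    g a = h (atLeast B (suc a))
    go : ∀ d v → U ≤ d + v → ∑ᴮ (B ∩ (v ≤ᵇ_)) g ≡ ∑[ j < atLeast B v ] h j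
    go zero v U≤v = trans (∑ᴮ-∅ _ _ none) (cong (λ M → ∑[ j < M ] h j) (sym (∑ᴮ-∅ _ _ none)))
      where
      none : ∀ a → a ∈ A → B a ∧ (v ≤ᵇ a) ≡ false
      none a a∈A = trans (cong (B a ∧_) (<⇒≤ᵇ≡false (<-≤-trans (lookup A<U a∈A) U≤v))) (∧-zeroʳ (B a))
    go (suc d) v U≤d+v = begin
      ∑ᴮ (B ∩ (v ≤ᵇ_)) g                                  ≡⟨ ∑ᴮ-≤ᵇ B v g ⟩
      ∑ᴮ (B ∩ (suc v ≤ᵇ_)) g + ∑ᴮ (B ∩ (v ≡ᵇ_)) g          ≡⟨ cong₂ _+_ (go d (suc v) U≤d+[1+v]) (∑ᴮ-single B g v) ⟩
      ∑[ j < atLeast B (suc v) ] h j + c * g v            ≡⟨ sumBelow-extend h (atLeast B (suc v)) c (#-single≤1 B v) ⟩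
      ∑[ j < atLeast B (suc v) + c ] h j                  ≡⟨ cong (λ M → ∑[ j < M ] h j) (sym (∑ᴮ-≤ᵇ B v (λ _ → 1))) ⟩
      ∑[ j < atLeast B v ] h j                            ∎
      where
      open ≡-Reasoning
      c : ℕ
      c = # (B ∩ (v ≡ᵇ_))
      U≤d+[1+v] : U ≤ d + suc v
      U≤d+[1+v] = ≤-trans U≤d+v (≤-reflexive (sym (+-suc d v)))

  ∑ᴮ-if : ∀ B P f g → ∑ᴮ[ a ∈ B ] (if P a then f a else g a) ≡ ∑ᴮ (B ∩ P) f + ∑ᴮ (B ∩ (not ∘ P)) g
  ∑ᴮ-if B P f g = trans (sumOver-cong pointwise A) (sumOver-+ _ _ A)
    where
    pointwise : ∀ a → (if B a then (if P a then f a else g a) else 0)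
                    ≡ (if B a ∧ P a then f a else 0) + (if B a ∧ not (P a) then g a else 0)
    pointwise a with B a | P a
    ... | true  | true  = sym (+-identityʳ (f a))
    ... | true  | false = refl
    ... | false | _     = refl

  -- The words of k distinct letters of B; when # B ≡ k these are the orderings of B.
  ∑Arr : ℕ → Subset → (List ℕ → ℕ) → ℕ
  ∑Arr k B f = ∑[ w ∈ words A k ] (if isArrangement B w then f w else 0)

  ∑Arr-suc : ∀ k B f → ∑Arr (suc k) B f ≡ ∑ᴮ[ a ∈ B ] ∑Arr k (B ∖ a) (λ w → f (a ∷ w))
  ∑Arr-suc k B f = begin
    sumOver g (concatMap (λ a → map (a ∷_) (words A k)) A) ≡⟨ sumOver-concatMap g _ A ⟩
    ∑[ a ∈ A ] sumOver g (map (a ∷_) (words A k))          ≡⟨ sumOver-cong (λ a → sumOver-map g (a ∷_) (words A k)) A ⟩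
    ∑[ a ∈ A ] ∑[ w ∈ words A k ] g (a ∷ w)                ≡⟨ sumOver-cong first-letter A ⟩
    ∑ᴮ[ a ∈ B ] ∑Arr k (B ∖ a) (λ w → f (a ∷ w))           ∎
    where
    open ≡-Reasoning
    g : List ℕ → ℕ
    g w = if isArrangement B w then f w else 0
    first-letter : ∀ a → ∑[ w ∈ words A k ] g (a ∷ w) ≡ (if B a then ∑Arr k (B ∖ a) (λ w → f (a ∷ w)) else 0)
    first-letter a = trans (sumOver-cong (λ w → cong (λ b → if b then f (a ∷ w) else 0) (isArrangement-∷ B a w)) (words A k))
                           (guarded (B a))
      where
      guarded : ∀ b → ∑[ w ∈ words A k ] (if b ∧ isArrangement (B ∖ a) w then f (a ∷ w) else 0)
                      ≡ (if b then ∑Arr k (B ∖ a) (λ w → f (a ∷ w)) else 0)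
      guarded true  = refl
      guarded false = sumOver-0 (words A k)

  ∑Arr-cong : ∀ k B {f g} → (∀ w → f w ≡ g w) → ∑Arr k B f ≡ ∑Arr k B g
  ∑Arr-cong k B f≗g = sumOver-cong (λ w → cong (λ z → if isArrangement B w then z else 0) (f≗g w)) (words A k)

  ∑Arr-+ : ∀ k B f g → ∑Arr k B (λ w → f w + g w) ≡ ∑Arr k B f + ∑Arr k B g
  ∑Arr-+ k B f g = trans (sumOver-cong pointwise (words A k)) (sumOver-+ _ _ (words A k))
    where
    pointwise : ∀ w → (if isArrangement B w then f w + g w else 0)
                    ≡ (if isArrangement B w then f w else 0) + (if isArrangement B w then g w else 0)
    pointwise w with isArrangement B w
    ... | true  = refl
    ... | false = refl

  ∑Arr-*ˡ : ∀ k B c f → ∑Arr k B (λ w → c * f w) ≡ c * ∑Arr k B f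
  ∑Arr-*ˡ k B c f = trans (sumOver-cong pointwise (words A k)) (sumOver-*ˡ c _ (words A k))
    where
    pointwise : ∀ w → (if isArrangement B w then c * f w else 0) ≡ c * (if isArrangement B w then f w else 0)
    pointwise w with isArrangement B w
    ... | true  = refl
    ... | false = sym (*-zeroʳ c)

  words-shape : ∀ k → All (λ w → length w ≡ k × All (_< U) w) (words A k)
  words-shape zero    = (refl , []) ∷ []
  words-shape (suc k) = All.concat⁺ (All.map⁺ (All.map prepend A<U))
    where
    prepend : ∀ {a} → a < U → All (λ w → length w ≡ suc k × All (_< U) w) (map (a ∷_) (words A k))
    prepend a<U = All.map⁺ (All.map (λ (len , w<U) → cong suc len , a<U ∷ w<U) (words-shape k))

  ∑Arr-mono : ∀ k B {f g} → (∀ w → length w ≡ k → All (_< U) w → f w ≤ g w) → ∑Arr k B f ≤ ∑Arr k B g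
  ∑Arr-mono k B f≤g = sumOver-monoᴬ (words-shape k) pointwise
    where
    pointwise : ∀ {w} → length w ≡ k × All (_< U) w → (if isArrangement B w then _ else 0) ≤ (if isArrangement B w then _ else 0)
    pointwise {w} (len , w<U) with isArrangement B w
    ... | true  = f≤g w len w<U
    ... | false = z≤n

  ∑Arr-suc-≤ : ∀ k B f h X → # B ≡ suc k → ∑ᴮ B h ≡ # B * X →
               (∀ a → a ∈ A → B a ≡ true → # (B ∖ a) ≡ k → ∑Arr k (B ∖ a) (λ w → f (a ∷ w)) ≤ k ! * h a) →
               ∑Arr (suc k) B f ≤ suc k ! * X
  ∑Arr-suc-≤ k B f h X #B ∑ᴮh by-first-letter = begin
    ∑Arr (suc k) B f                              ≡⟨ ∑Arr-suc k B f ⟩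
    ∑ᴮ[ a ∈ B ] ∑Arr k (B ∖ a) (λ w → f (a ∷ w)) ≤⟨ ∑ᴮ-mono B (λ a a∈A Ba → by-first-letter a a∈A Ba (#-∖≡k a∈A Ba)) ⟩
    ∑ᴮ[ a ∈ B ] (k ! * h a)                       ≡⟨ ∑ᴮ-*ˡ B (k !) h ⟩
    k ! * ∑ᴮ B h                                  ≡⟨ cong (k ! *_) (trans ∑ᴮh (cong (_* X) #B)) ⟩
    k ! * (suc k * X)                             ≡⟨ x*[y*z]≡y*[x*z] (k !) (suc k) X ⟩
    suc k * (k ! * X)                             ≡⟨ sym (*-assoc (suc k) (k !) X) ⟩
    suc k ! * X                                   ∎
    where
    open ≤-Reasoning
    #-∖≡k : ∀ {a} → a ∈ A → B a ≡ true → # (B ∖ a) ≡ k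
    #-∖≡k a∈A Ba = suc-injective (trans (sym (#-∖ B a∈A Ba)) #B)

  ∑Arr-1 : ∀ k B → # B ≡ k → ∑Arr k B (λ _ → 1) ≤ k !
  ∑Arr-1 zero    B _  = ≤-refl
  ∑Arr-1 (suc k) B #B = ≤-trans
    (∑Arr-suc-≤ k B _ (λ _ → 1) 1 #B (sym (*-identityʳ (# B)))
                (λ a _ _ #B∖a → ≤-trans (∑Arr-1 k (B ∖ a) #B∖a) (≤-reflexive (sym (*-identityʳ (k !))))))
    (≤-reflexive (*-identityʳ (suc k !)))

  -- A first letter a < v doubles 2 ^ ltrMinima v and becomes the new threshold.
  minimaWeight : Subset → ℕ → ℕ → ℕ
  minimaWeight B v a = if a <ᵇ v then 2 * suc (below B a) else suc (below B v)

  ∑ᴮ-minimaWeight : ∀ B v → ∑ᴮ B (minimaWeight B v) ≡ # B * suc (below B v)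
  ∑ᴮ-minimaWeight B v = begin
    ∑ᴮ B (minimaWeight B v)                ≡⟨ ∑ᴮ-if B (_<ᵇ v) _ _ ⟩
    ∑ᴮ[ a ∈ B ∩ (_<ᵇ v) ] (2 * suc (below B a)) + ∑ᴮ[ _ ∈ B ∩ (not ∘ (_<ᵇ v)) ] suc M
                                           ≡⟨ cong₂ _+_ (∑ᴮ-rank-below B (λ j → 2 * suc j) v) (∑ᴮ-const _ (suc M)) ⟩
    ∑[ j < M ] (2 * suc j) + C * suc M     ≡⟨ cong (_+ C * suc M) (∑[j<M]2[1+j]≡M[1+M] M) ⟩
    M * suc M + C * suc M                  ≡⟨ sym (*-distribʳ-+ (suc M) M C) ⟩
    (M + C) * suc M                        ≡⟨ cong (_* suc M) (sym (∑ᴮ-split B (_<ᵇ v) (λ _ → 1))) ⟩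
    # B * suc M                            ∎
    where
    open ≡-Reasoning
    M C : ℕ
    M = below B v
    C = # (B ∩ (not ∘ (_<ᵇ v)))

  ∑Arr-2^ltrMinima : ∀ k B v → # B ≡ k → ∑Arr k B (λ w → 2 ^ ltrMinima v w) ≤ k ! * suc (below B v)
  ∑Arr-2^ltrMinima zero    B v _  = s≤s z≤n
  ∑Arr-2^ltrMinima (suc k) B v #B = ∑Arr-suc-≤ k B _ (minimaWeight B v) _ #B (∑ᴮ-minimaWeight B v) by-first-letter
    where
    open ≤-Reasoning
    by-first-letter : ∀ a → a ∈ A → B a ≡ true → # (B ∖ a) ≡ k →
                      ∑Arr k (B ∖ a) (λ w → 2 ^ ltrMinima v (a ∷ w)) ≤ k ! * minimaWeight B v a
    by-first-letter a _ _ #B∖a with a <ᵇ v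
    ... | true  = begin
      ∑Arr k (B ∖ a) (λ w → 2 * 2 ^ ltrMinima a w) ≡⟨ ∑Arr-*ˡ k (B ∖ a) 2 _ ⟩
      2 * ∑Arr k (B ∖ a) (λ w → 2 ^ ltrMinima a w) ≤⟨ *-monoʳ-≤ 2 (∑Arr-2^ltrMinima k (B ∖ a) a #B∖a) ⟩
      2 * (k ! * suc (below (B ∖ a) a))            ≡⟨ cong (λ m → 2 * (k ! * suc m)) (below-∖ B a) ⟩
      2 * (k ! * suc (below B a))                  ≡⟨ x*[y*z]≡y*[x*z] 2 (k !) (suc (below B a)) ⟩
      k ! * (2 * suc (below B a))                  ∎
    ... | false = begin
      ∑Arr k (B ∖ a) (λ w → 2 ^ ltrMinima v w) ≤⟨ ∑Arr-2^ltrMinima k (B ∖ a) v #B∖a ⟩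
      k ! * suc (below (B ∖ a) v)              ≤⟨ *-monoʳ-≤ (k !) (s≤s (#∩-∖-≤ B (_<ᵇ v) a)) ⟩
      k ! * suc (below B v)                    ∎

  -- An increasing subsequence avoids the first letter a, or starts at a (if v ≤ a) and
  -- continues with letters ≥ a.
  incWeight : Subset → ℕ → ℕ → ℕ → ℕ
  incWeight B v b a =
    if v ≤ᵇ a then pred (atLeast B v) P′ suc b + suc b * suc b * (atLeast B (suc a) P′ b) else atLeast B v P′ suc b

  ∑ᴮ-incWeight : ∀ B v b → ∑ᴮ B (incWeight B v b) ≡ # B * (atLeast B v P′ suc b)
  ∑ᴮ-incWeight B v b = begin
    ∑ᴮ B (incWeight B v b)
      ≡⟨ ∑ᴮ-if B (v ≤ᵇ_) _ _ ⟩
    ∑ᴮ[ a ∈ B ∩ (v ≤ᵇ_) ] (pred M P′ suc b + suc b * suc b * (atLeast B (suc a) P′ b)) + ∑ᴮ[ _ ∈ B ∩ (not ∘ (v ≤ᵇ_)) ] G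
      ≡⟨ cong₂ _+_ (trans (∑ᴮ-+ (B ∩ (v ≤ᵇ_)) _ _) (cong₂ _+_ (∑ᴮ-const _ _) (∑ᴮ-*ˡ (B ∩ (v ≤ᵇ_)) (suc b * suc b) _)))
                   (∑ᴮ-const _ G) ⟩
    M * (pred M P′ suc b) + suc b * suc b * ∑ᴮ[ a ∈ B ∩ (v ≤ᵇ_) ] (atLeast B (suc a) P′ b) + C * G
      ≡⟨ cong (λ s → M * (pred M P′ suc b) + suc b * suc b * s + C * G) (∑ᴮ-rank-atLeast B (_P′ b) v) ⟩
    M * (pred M P′ suc b) + suc b * suc b * ∑[ j < M ] (j P′ b) + C * G
      ≡⟨ cong₂ (λ x y → x + y + C * G) (n*[pred-n]P′k≡nP′[1+k] M (suc b))
               (trans (*-assoc (suc b) (suc b) _) (cong (suc b *_) ([1+b]*∑[j<M]jP′b≡MP′[1+b] b M))) ⟩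
    M P′ suc (suc b) + suc b * G + C * G
      ≡⟨ cong (_+ C * G) (nP′[1+k]+k*nP′k≡n*nP′k M (suc b)) ⟩
    M * G + C * G
      ≡⟨ sym (*-distribʳ-+ G M C) ⟩
    (M + C) * G
      ≡⟨ cong (_* G) (sym (∑ᴮ-split B (v ≤ᵇ_) (λ _ → 1))) ⟩
    # B * G ∎
    where
    open ≡-Reasoning
    M C G : ℕ
    M = atLeast B v
    C = # (B ∩ (not ∘ (v ≤ᵇ_)))
    G = M P′ suc b

  ∑Arr-numIncSubseqs : ∀ k b B v → # B ≡ k → (b ! * b !) * ∑Arr k B (numIncSubseqs v b) ≤ k ! * (atLeast B v P′ b)
  ∑Arr-numIncSubseqs k zero B v #B =
    ≤-trans (≤-reflexive (+-identityʳ _)) (≤-trans (∑Arr-1 k B #B) (≤-reflexive (sym (*-identityʳ (k !)))))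
  ∑Arr-numIncSubseqs zero (suc b) B v _ = ≤-trans (≤-reflexive (*-zeroʳ (suc b ! * suc b !))) z≤n
  ∑Arr-numIncSubseqs (suc k) (suc b) B v #B = begin
    c * ∑Arr (suc k) B (numIncSubseqs v (suc b))          ≡⟨ sym (∑Arr-*ˡ (suc k) B c _) ⟩
    ∑Arr (suc k) B (λ w → c * numIncSubseqs v (suc b) w) ≤⟨ ∑Arr-suc-≤ k B _ _ _ #B (∑ᴮ-incWeight B v b) by-first-letter ⟩
    suc k ! * (atLeast B v P′ suc b)                      ∎
    where
    open ≤-Reasoning
    c : ℕ
    c = suc b ! * suc b !
    by-first-letter : ∀ a → a ∈ A → B a ≡ true → # (B ∖ a) ≡ k →
                      ∑Arr k (B ∖ a) (λ w → c * numIncSubseqs v (suc b) (a ∷ w)) ≤ k ! * incWeight B v b a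
    by-first-letter a a∈A Ba #B∖a with v ≤ᵇ a in v≤a
    ... | true  = begin
      ∑Arr k (B ∖ a) (λ w → c * (numIncSubseqs v (suc b) w + numIncSubseqs a b w))
        ≡⟨ trans (∑Arr-*ˡ k (B ∖ a) c _) (cong (c *_) (∑Arr-+ k (B ∖ a) _ _)) ⟩
      c * (∑Arr k (B ∖ a) (numIncSubseqs v (suc b)) + ∑Arr k (B ∖ a) (numIncSubseqs a b))
        ≡⟨ regroup (suc b) (b !) (∑Arr k (B ∖ a) (numIncSubseqs v (suc b))) (∑Arr k (B ∖ a) (numIncSubseqs a b)) ⟩
      c * ∑Arr k (B ∖ a) (numIncSubseqs v (suc b)) + suc b * suc b * ((b ! * b !) * ∑Arr k (B ∖ a) (numIncSubseqs a b))
        ≤⟨ +-mono-≤ (∑Arr-numIncSubseqs k (suc b) (B ∖ a) v #B∖a)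
                    (*-monoʳ-≤ (suc b * suc b) (∑Arr-numIncSubseqs k b (B ∖ a) a #B∖a)) ⟩
      k ! * (atLeast (B ∖ a) v P′ suc b) + suc b * suc b * (k ! * (atLeast (B ∖ a) a P′ b))
        ≡⟨ cong₂ (λ m m′ → k ! * (m P′ suc b) + suc b * suc b * (k ! * (m′ P′ b)))
                 (cong pred (sym (#∩-∖ B (v ≤ᵇ_) a∈A Ba v≤a))) (atLeast-∖ B a) ⟩
      k ! * (pred (atLeast B v) P′ suc b) + suc b * suc b * (k ! * (atLeast B (suc a) P′ b))
        ≡⟨ factor (k !) (pred (atLeast B v) P′ suc b) (suc b * suc b) (atLeast B (suc a) P′ b) ⟩
      k ! * (pred (atLeast B v) P′ suc b + suc b * suc b * (atLeast B (suc a) P′ b)) ∎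
      where
      regroup : ∀ s f x y → (s * f) * (s * f) * (x + y) ≡ (s * f) * (s * f) * x + s * s * ((f * f) * y)
      regroup = solve-∀
      factor : ∀ f p s q → f * p + s * (f * q) ≡ f * (p + s * q)
      factor = solve-∀
    ... | false = begin
      ∑Arr k (B ∖ a) (λ w → c * (numIncSubseqs v (suc b) w + 0))
        ≡⟨ ∑Arr-cong k (B ∖ a) (λ w → cong (c *_) (+-identityʳ _)) ⟩
      ∑Arr k (B ∖ a) (λ w → c * numIncSubseqs v (suc b) w)
        ≡⟨ ∑Arr-*ˡ k (B ∖ a) c _ ⟩
      c * ∑Arr k (B ∖ a) (numIncSubseqs v (suc b))
        ≤⟨ ∑Arr-numIncSubseqs k (suc b) (B ∖ a) v #B∖a ⟩
      k ! * (atLeast (B ∖ a) v P′ suc b)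
        ≤⟨ *-monoʳ-≤ (k !) (P′-mono (suc b) (#∩-∖-≤ B (v ≤ᵇ_) a)) ⟩
      k ! * (atLeast B v P′ suc b) ∎

noLateral-weighted-bound : ∀ v w a b → All (_< v) w → a * b < length w →
  2 ^ suc a * 𝟙 (proj₂ (schensted w)) ≤ 2 ^ ltrMinima v w + 2 ^ suc a * numIncSubseqs 0 (suc b) w
noLateral-weighted-bound v w a b w<v small with proj₂ (schensted w) in noLateral
... | false = ≤-trans (≤-reflexive (*-zeroʳ (2 ^ suc a))) z≤n
... | true with noLateral-dichotomy v w a b w<v noLateral small
...   | inj₁ many-minima = ≤-trans (≤-reflexive (*-identityʳ _)) (≤-trans (^-monoʳ-≤ 2 many-minima) (m≤m+n _ _))
...   | inj₂ long-incSubseq = ≤-trans (*-monoʳ-≤ (2 ^ suc a) long-incSubseq) (m≤n+m _ _)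

length-filter-unique : ∀ (p : List ℕ → Bool) xs →
  length (filter (λ w → p w ≟ᴮ true) (filter unique? xs)) ≡ ∑[ w ∈ xs ] (if does (unique? w) then 𝟙 (p w) else 0)
length-filter-unique p [] = refl
length-filter-unique p (x ∷ xs) with does (unique? x)
... | false = length-filter-unique p xs
... | true with p x
...   | true  = cong suc (length-filter-unique p xs)
...   | false = length-filter-unique p xs

all-true : ∀ (w : List ℕ) → all (λ _ → true) w ≡ true
all-true []      = refl
all-true (_ ∷ w) = all-true w

module Permutations (n : ℕ) where

  A : List ℕ
  A = map suc (upTo n)

  A-unique : Unique A
  A-unique = Unique.map⁺ suc-injective (Unique.upTo⁺ n)

  A<1+n : All (_< suc n) A
  A<1+n = All.map⁺ (All.applyUpTo⁺₁ (λ i → i) n s≤s)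

  open Arrangements A A-unique (suc n) A<1+n public

  everything : Subset
  everything _ = true

  #everything : # everything ≡ n
  #everything = trans (sumOver-ones A) (trans (length-map suc (upTo n)) (length-applyUpTo (λ i → i) n))
    where
    sumOver-ones : ∀ (xs : List ℕ) → ∑[ _ ∈ xs ] 1 ≡ length xs
    sumOver-ones []       = refl
    sumOver-ones (_ ∷ xs) = cong suc (sumOver-ones xs)

  countV≡∑Arr : countV n ≡ ∑Arr n everything (λ w → 𝟙 (proj₂ (schensted w)))
  countV≡∑Arr = trans (length-filter-unique (λ w → proj₂ (schensted w)) (words A n)) (sumOver-cong unique⇔arrangement (words A n))
    where
    unique⇔arrangement : ∀ w → (if does (unique? w) then 𝟙 (proj₂ (schensted w)) else 0)
                             ≡ (if isArrangement everything w then 𝟙 (proj₂ (schensted w)) else 0)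
    unique⇔arrangement w = cong (λ b → if b then 𝟙 (proj₂ (schensted w)) else 0) (sym (cong (_∧ does (unique? w)) (all-true w)))

  countV-bound : ∀ a b → a * b < n →
    2 ^ suc a * countV n ≤ n ! * suc n + 2 ^ suc a * ∑Arr n everything (numIncSubseqs 0 (suc b))
  countV-bound a b small = begin
    P * countV n
      ≡⟨ trans (cong (P *_) countV≡∑Arr) (sym (∑Arr-*ˡ n everything P _)) ⟩
    ∑Arr n everything (λ w → P * 𝟙 (proj₂ (schensted w)))
      ≤⟨ ∑Arr-mono n everything pointwise ⟩
    ∑Arr n everything (λ w → 2 ^ ltrMinima (suc n) w + P * numIncSubseqs 0 (suc b) w)
      ≡⟨ trans (∑Arr-+ n everything _ _) (cong (_ +_) (∑Arr-*ˡ n everything P _)) ⟩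
    ∑Arr n everything (λ w → 2 ^ ltrMinima (suc n) w) + P * ∑Arr n everything (numIncSubseqs 0 (suc b))
      ≤⟨ +-monoˡ-≤ _ (≤-trans (∑Arr-2^ltrMinima n everything (suc n) #everything) (*-monoʳ-≤ (n !) (s≤s below≤n))) ⟩
    n ! * suc n + P * ∑Arr n everything (numIncSubseqs 0 (suc b))
      ∎
    where
    open ≤-Reasoning
    P : ℕ
    P = 2 ^ suc a
    pointwise : ∀ w → length w ≡ n → All (_< suc n) w →
                P * 𝟙 (proj₂ (schensted w)) ≤ 2 ^ ltrMinima (suc n) w + P * numIncSubseqs 0 (suc b) w
    pointwise w len w<1+n = noLateral-weighted-bound (suc n) w a b w<1+n (subst (a * b <_) (sym len) small)
    below≤n : below everything (suc n) ≤ n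
    below≤n = ≤-trans (sumOver-mono (λ x → 𝟙≤1 (x <ᵇ suc n)) A) (≤-reflexive #everything)

  incSubseqs-bound : ∀ b → (b ! * b !) * ∑Arr n everything (numIncSubseqs 0 b) ≤ n ! * n ^ b
  incSubseqs-bound b = ≤-trans (∑Arr-numIncSubseqs n b everything 0 #everything)
                               (*-monoʳ-≤ (n !) (≤-trans (≤-reflexive (cong (_P′ b) #everything)) (P′≤^ n b)))

countV-small : ∀ K n → Parameters K n → K * countV n < n !
countV-small K n params =
  two-term-bound K (countV n) (n !) n (n ^ suc b) (suc b ! * suc b !) (2 ^ suc a) _
    (countV-bound a b a*b<n) (incSubseqs-bound (suc b)) 2K[1+n]≤2^[1+a] 2Kn^[1+b]<[1+b]!² (1≤n! n) (m^n>0 2 (suc a))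
  where
  open Parameters params
  open Permutations n

theorem1p2 : ∀ (k : ℕ) → ∃[ N ] (∀ (n : ℕ) → N ≤ n → suc k * countV n < n !)
theorem1p2 k with parameters-exist (suc k)
... | N , parameters = N , λ n N≤n → countV-small (suc k) n (parameters n N≤n)
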